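{- Let $r\geq 3$ be an integer and let $\mathcal{B}$ be a linear class of Hamiltonian cycles in $\Delta_{r}$. The cyclic flats of $L(\Delta_{r},\mathcal{B})$ are exactly the following: (i) the ground set, which has rank $r$; (ii) the empty set, which has rank $0$; (iii) the edge-set of each cycle in $\mathcal{B}$, each of rank $r-1$; (iv) every union of $p$ parallel pairs of $\Delta_{r}$ with $2\leq p\leq r-2$, which has rank $p+1$.
   Context: Graphs may have loops and parallel edges. A theta-subgraph of a graph $G$ consists of two distinct vertices $u,v$ and three internally vertex-disjoint $u$–$v$ paths. A linear class is a collection $\mathcal{B}$ of cycles of $G$ such that no theta-subgraph contains exactly two cycles of $\mathcal{B}$; cycles in $\mathcal{B}$ are balanced, others unbalanced. The lift matroid $L(G,\mathcal{B})$ on $E(G)$ has as circuits the edge-sets of balanced cycles, of theta-subgraphs containing an unbalanced cycle, and of unions of two unbalanced cycles sharing at most one vertex. $\Delta_{r}$ is obtained from a cycle with $r$ edges by replacing each edge by a parallel pair. A cyclic flat is a flat that is a (possibly empty) union of circuits. -}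

module Defs where

open import Data.Nat using (ℕ; zero; suc; _≤_; _∸_; _*_)
open import Data.Nat.DivMod using (_%_; m%n<n)
open import Data.Fin using (Fin; toℕ; fromℕ<; remQuot)
open import Data.Fin.Subset using (Subset; _∈_; _∉_; _⊆_; _∪_; ⁅_⁆; ∣_∣; ⊥; ⊤)
open import Data.Vec using (tabulate; lookup)
open import Data.List using (List; []; _∷_; foldr)
import Data.List.Membership.Propositional as LM
open import Data.List.Relation.Unary.Unique.Propositional using (Unique)
open import Data.Product using (Σ; ∃; ∃₂; _×_; _,_; proj₁; proj₂)
open import Data.Sum using (_⊎_)
import Data.Empty as Empty
open import Relation.Binary.PropositionalEquality using (_≡_; _≢_)
open import Relation.Nullary using (¬_)

-- Finite multigraphs (loops and parallel edges allowed):
-- vertices Fin nV, edges Fin nE, each edge with its (unordered) pair of ends.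

record Graph : Set where
  field
    nV : ℕ
    nE : ℕ
    ends : Fin nE → Fin nV × Fin nV

listToSet : ∀ {m} → List (Fin m) → Subset m
listToSet = foldr (λ e s → ⁅ e ⁆ ∪ s) ⊥

module _ (G : Graph) where
  open Graph G

  Joins : Fin nE → Fin nV → Fin nV → Set
  Joins e u w = ends e ≡ (u , w) ⊎ ends e ≡ (w , u)

  data Walk : Fin nV → Fin nV → Set where
    nil  : ∀ {u} → Walk u u
    cons : ∀ {u w x} (e : Fin nE) → Joins e u w → Walk w x → Walk u x

  verts : ∀ {u v} → Walk u v → List (Fin nV)
  verts {u} nil = u ∷ []
  verts {u} (cons e _ p) = u ∷ verts p

  edges : ∀ {u v} → Walk u v → List (Fin nE)
  edges nil = []
  edges (cons e _ p) = e ∷ edges p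

  IsPath : ∀ {u v} → Walk u v → Set
  IsPath p = Unique (verts p)

  -- a cycle: an edge e from u to w closed up by a w–u path not using e
  -- (u ≡ w gives a loop, a single further edge gives a 2-cycle)
  record CycleW : Set where
    field
      u w   : Fin nV
      e     : Fin nE
      joins : Joins e u w
      path  : Walk w u
      isPath : IsPath path
      fresh : ¬ (e LM.∈ edges path)

  cycleEdges : CycleW → Subset nE
  cycleEdges c = listToSet (CycleW.e c ∷ edges (CycleW.path c))

  IsCycle : Subset nE → Set
  IsCycle C = Σ CycleW (λ c → cycleEdges c ≡ C)

  IsHamCycle : Subset nE → Set
  IsHamCycle C = Σ CycleW (λ c → (cycleEdges c ≡ C)
                   × (∀ x → x LM.∈ verts (CycleW.path c)))

  -- theta-subgraph: distinct u, v and three internally vertex-disjoint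
  -- (hence pairwise distinct, i.e. edge-disjoint) u–v paths
  record ThetaW : Set where
    field
      u v : Fin nV
      u≢v : u ≢ v
      P : Fin 3 → Walk u v
      paths : ∀ i → IsPath (P i)
      intDisj : ∀ i j → i ≢ j → ∀ x → x LM.∈ verts (P i) → x LM.∈ verts (P j)
                → x ≡ u ⊎ x ≡ v
      edgeDisj : ∀ i j → i ≢ j → ∀ e → e LM.∈ edges (P i) → e LM.∈ edges (P j)
                 → Empty.⊥

  thetaEdges : ThetaW → Subset nE
  thetaEdges t = listToSet (edges (ThetaW.P t Fin.zero))
               ∪ (listToSet (edges (ThetaW.P t (Fin.suc Fin.zero)))
               ∪ listToSet (edges (ThetaW.P t (Fin.suc (Fin.suc Fin.zero)))))
    where import Data.Fin as Fin

  IsTheta : Subset nE → Set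
  IsTheta T = Σ ThetaW (λ t → thetaEdges t ≡ T)

  ExactlyTwoIn : (Subset nE → Set) → Subset nE → Set
  ExactlyTwoIn B T = ∃₂ λ C₁ C₂ → C₁ ≢ C₂
    × IsCycle C₁ × IsCycle C₂ × C₁ ⊆ T × C₂ ⊆ T × B C₁ × B C₂
    × (∀ C → IsCycle C → C ⊆ T → B C → C ≡ C₁ ⊎ C ≡ C₂)

  IsLinearClass : (Subset nE → Set) → Set
  IsLinearClass B = (∀ C → B C → IsCycle C)
                  × (∀ T → IsTheta T → ¬ ExactlyTwoIn B T)

  VertOf : Subset nE → Fin nV → Set
  VertOf C x = ∃ λ e → e ∈ C × (proj₁ (ends e) ≡ x ⊎ proj₂ (ends e) ≡ x)

  LiftCircuit : (Subset nE → Set) → Subset nE → Set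
  LiftCircuit B X =
      (IsCycle X × B X)
    ⊎ (IsTheta X × ∃ λ C → IsCycle C × C ⊆ X × ¬ B C)
    ⊎ (∃₂ λ C₁ C₂ → IsCycle C₁ × IsCycle C₂ × ¬ B C₁ × ¬ B C₂ × C₁ ≢ C₂
         × (∀ x y → VertOf C₁ x → VertOf C₂ x → VertOf C₁ y → VertOf C₂ y → x ≡ y)
         × X ≡ C₁ ∪ C₂)

module _ {m : ℕ} (Circuit : Subset m → Set) where

  Independent : Subset m → Set
  Independent I = ∀ C → Circuit C → C ⊆ I → Empty.⊥

  HasRank : Subset m → ℕ → Set
  HasRank X k = (∃ λ I → I ⊆ X × Independent I × ∣ I ∣ ≡ k)
              × (∀ I → I ⊆ X → Independent I → ∣ I ∣ ≤ k)

  IsFlat : Subset m → Set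
  IsFlat X = ∀ e → e ∉ X → ∀ k → HasRank X k → ¬ HasRank (X ∪ ⁅ e ⁆) k

  IsUnionOfCircuits : Subset m → Set
  IsUnionOfCircuits X = ∀ e → e ∈ X → ∃ λ C → Circuit C × C ⊆ X × e ∈ C

  IsCyclicFlat : Subset m → Set
  IsCyclicFlat X = IsFlat X × IsUnionOfCircuits X

-- Δ_r: the r-cycle on vertices Fin r (vertex i adjacent to i+1 mod r)
-- with every edge doubled.  Edge e ∈ Fin (r * 2) belongs to the parallel
-- pair number proj₁ (remQuot 2 e) (the two copies are distinguished by
-- proj₂ (remQuot 2 e)).

next : ∀ {r} → Fin r → Fin r
next {suc n} i = fromℕ< (m%n<n (suc (toℕ i)) (suc n))

pairOf : ∀ {r} → Fin (r * 2) → Fin r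
pairOf e = proj₁ (remQuot 2 e)

Δ : ℕ → Graph
Δ r = record
  { nV = r
  ; nE = r * 2
  ; ends = λ e → (pairOf e , next (pairOf e))
  }

pairsUnion : ∀ {r} → Subset r → Subset (r * 2)
pairsUnion S = tabulate (λ e → lookup S (pairOf e))

IsUnionOfPairs : ∀ r → Subset (r * 2) → ℕ → Set
IsUnionOfPairs r X p = ∃ λ (S : Subset r) → ∣ S ∣ ≡ p × X ≡ pairsUnion S

module Submission where

-- Write T(X) and D(X) for the parallel pairs that an edge set X of Δ_r meets, respectively
-- contains, so that |X| = |T(X)| + |D(X)|.  A cycle of Δ_r is a parallel pair (unbalanced, as B
-- consists of Hamiltonian cycles) or a transversal of all r pairs, so the circuits of L(Δ_r, B)
-- are the balanced Hamiltonian cycles, the theta-subgraphs (a full pair plus one edge of every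
-- other pair) and the handcuffs (two full pairs).  Hence X is independent iff either |D(X)| ≤ 1
-- and X misses some pair, or X is an unbalanced Hamiltonian cycle; this yields all the ranks.
-- A cyclic flat X ≠ E has no independent subset of size r, for X and X ∪ {e} would then both
-- have rank r.  So X contains no theta and no transversal together with a full pair, and its
-- circuits are either a balanced Hamiltonian cycle, which is then all of X, or handcuffs, in
-- which case X is the union of its p full pairs; p ≠ r − 1, since r − 1 full pairs contain one
-- full pair plus one edge of each other pair, an independent set of size r.

open import Defs
open import Data.Nat using (ℕ; zero; suc; _+_; _≤_; _<_; _∸_; _*_; z≤n; s≤s)
import Data.Nat.Properties as NP
open import Data.Nat.DivMod using (_%_; m%n<n; m<n⇒m%n≡m; n%n≡0)
open import Data.Bool using (Bool; true; false; _∧_; _∨_; not; if_then_else_)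
open import Data.Bool.Properties using (¬-not; ∧-idem; ∨-idem; ∧-identityʳ)
open import Data.Fin using (Fin; zero; suc; toℕ; fromℕ<; remQuot; combine; fromℕ; inject₁; _≟_)
import Data.Fin.Properties as FP
open import Data.Fin.Subset using (Subset; _∈_; _∉_; _⊆_; _∪_; ⁅_⁆; ∣_∣; ⊥; ⊤; ∁; Nonempty)
import Data.Fin.Subset.Properties as SP
open import Data.Vec using ([]; _∷_; tabulate; lookup)
import Data.Vec.Properties as VP
open import Data.List using (List; []; _∷_)
import Data.List.Membership.Propositional as LM
open import Data.List.Relation.Unary.Any using (here; there)
open import Data.List.Relation.Unary.All as All using (All; []; _∷_)
open import Data.List.Relation.Unary.All.Properties using (All¬⇒¬Any)
open import Data.List.Relation.Unary.AllPairs using ([]; _∷_)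
open import Data.Product using (∃; ∃₂; _×_; _,_; proj₁; proj₂)
open import Function using (_∘_)
open import Data.Sum using (_⊎_; inj₁; inj₂; [_,_])
import Data.Empty as E
open import Data.Unit using (tt)
open import Function.Bundles using (_⇔_; mk⇔)
open import Relation.Binary.PropositionalEquality hiding ([_]; J)
open import Relation.Nullary using (¬_; yes; no; Dec; does)
open import Relation.Nullary.Decidable using (dec-true)
open import Algebra.Properties.CommutativeSemigroup NP.+-commutativeSemigroup using (x∙yz≈y∙xz; xy∙z≈zx∙y)

∈⇒lookup : ∀ {m} {p : Subset m} {x} → x ∈ p → lookup p x ≡ true
∈⇒lookup = VP.[]=⇒lookup

lookup⇒∈ : ∀ {m} {p : Subset m} {x} → lookup p x ≡ true → x ∈ p
lookup⇒∈ {p = p} {x} = VP.lookup⇒[]= x p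

true≢false : true ≢ false
true≢false ()

≡-from-≡true : ∀ {a b : Bool} → (a ≡ true → b ≡ true) → (b ≡ true → a ≡ true) → a ≡ b
≡-from-≡true {false} {false} f g = refl
≡-from-≡true {false} {true}  f g = g refl
≡-from-≡true {true}  {false} f g = sym (f refl)
≡-from-≡true {true}  {true}  f g = refl

∨-true⁺ : ∀ {a b} → a ≡ true ⊎ b ≡ true → (a ∨ b) ≡ true
∨-true⁺ {true}  _        = refl
∨-true⁺ {false} (inj₂ e) = e

∨-true⁻ : ∀ a {b} → (a ∨ b) ≡ true → a ≡ true ⊎ b ≡ true
∨-true⁻ true  _ = inj₁ refl
∨-true⁻ false e = inj₂ e

∧-true⁺ : ∀ {a b} → a ≡ true → b ≡ true → (a ∧ b) ≡ true
∧-true⁺ refl refl = refl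

∧-trueˡ : ∀ a {b} → (a ∧ b) ≡ true → a ≡ true
∧-trueˡ true _ = refl

∧-trueʳ : ∀ a {b} → (a ∧ b) ≡ true → b ≡ true
∧-trueʳ true e = e

⊥-or-nonempty : ∀ {m} (X : Subset m) → X ≡ ⊥ ⊎ Nonempty X
⊥-or-nonempty X with SP.nonempty? X
... | yes ne = inj₂ ne
... | no ¬ne = inj₁ (SP.Empty-unique ¬ne)

⊤-or-missing : ∀ {m} (X : Subset m) → X ≡ ⊤ ⊎ ∃ λ k → k ∉ X
⊤-or-missing X with SP.nonempty? (∁ X)
... | yes (k , k∈∁X) = inj₂ (k , SP.x∈∁p⇒x∉p k∈∁X)
... | no ¬ne = inj₁ (SP.⊆-antisym SP.⊆⊤ (λ {k} _ → SP.x∉∁p⇒x∈p (λ k∈∁X → ¬ne (k , k∈∁X))))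

∈⇒∈listToSet : ∀ {m} (l : List (Fin m)) {k} → k LM.∈ l → k ∈ listToSet l
∈⇒∈listToSet (x ∷ l) (here refl) = SP.p⊆p∪q (listToSet l) (SP.x∈⁅x⁆ x)
∈⇒∈listToSet (x ∷ l) (there h)   = SP.q⊆p∪q ⁅ x ⁆ (listToSet l) (∈⇒∈listToSet l h)

∈listToSet⇒∈ : ∀ {m} (l : List (Fin m)) {k} → k ∈ listToSet l → k LM.∈ l
∈listToSet⇒∈ [] h = E.⊥-elim (SP.∉⊥ h)
∈listToSet⇒∈ (x ∷ l) h with SP.x∈p∪q⁻ ⁅ x ⁆ (listToSet l) h
... | inj₁ h₁ = here (SP.x∈⁅y⁆⇒x≡y x h₁)
... | inj₂ h₂ = there (∈listToSet⇒∈ l h₂)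

-- Counting

indicator : Bool → ℕ
indicator true  = 1
indicator false = 0

count : ∀ {r} → (Fin r → Bool) → ℕ
count {zero}  h = 0
count {suc r} h = indicator (h zero) + count (λ i → h (suc i))

indicator≤1 : ∀ b → indicator b ≤ 1
indicator≤1 true  = s≤s z≤n
indicator≤1 false = z≤n

indicator-mono : ∀ {a b} → (a ≡ true → b ≡ true) → indicator a ≤ indicator b
indicator-mono {false} f = z≤n
indicator-mono {true}  f rewrite f refl = s≤s z≤n

count≤ : ∀ {r} (h : Fin r → Bool) → count h ≤ r
count≤ {zero}  h = z≤n
count≤ {suc r} h = NP.+-mono-≤ (indicator≤1 (h zero)) (count≤ (λ i → h (suc i)))

count-all : ∀ {r} (h : Fin r → Bool) → (∀ i → h i ≡ true) → count h ≡ r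
count-all {zero}  h a = refl
count-all {suc r} h a rewrite a zero = cong suc (count-all (λ i → h (suc i)) (λ i → a (suc i)))

count-none : ∀ {r} (h : Fin r → Bool) → (∀ i → h i ≡ false) → count h ≡ 0
count-none {zero}  h a = refl
count-none {suc r} h a rewrite a zero = count-none (λ i → h (suc i)) (λ i → a (suc i))

count< : ∀ {r} (h : Fin r → Bool) z → h z ≡ false → count h < r
count< {suc r} h zero e rewrite e = s≤s (count≤ (λ i → h (suc i)))
count< {suc r} h (suc z) e with h zero
... | true  = s≤s (count< (λ i → h (suc i)) z e)
... | false = NP.m≤n⇒m≤1+n (count< (λ i → h (suc i)) z e)

count<⇒false : ∀ {r} (h : Fin r → Bool) → count h < r → ∃ λ z → h z ≡ false
count<⇒false {suc r} h lt with h zero in eq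
... | false = zero , eq
... | true with count<⇒false (λ i → h (suc i)) (NP.≤-pred lt)
... | z , e = suc z , e

count≥1⇒true : ∀ {r} (h : Fin r → Bool) → 1 ≤ count h → ∃ λ i → h i ≡ true
count≥1⇒true {suc r} h lt with h zero in eq
... | true = zero , eq
... | false with count≥1⇒true (λ i → h (suc i)) lt
... | z , e = suc z , e

count≥2⇒true : ∀ {r} (h : Fin r → Bool) → 2 ≤ count h
             → ∃₂ λ i j → i ≢ j × h i ≡ true × h j ≡ true
count≥2⇒true {suc r} h lt with h zero in eq
... | true with count≥1⇒true (λ i → h (suc i)) (NP.≤-pred lt)
... | z , e = zero , suc z , (λ ()) , eq , e
count≥2⇒true {suc r} h lt | false with count≥2⇒true (λ i → h (suc i)) lt
... | i , j , i≢j , e₁ , e₂ = suc i , suc j , (λ q → i≢j (FP.suc-injective q)) , e₁ , e₂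

true⇒count≥1 : ∀ {r} (h : Fin r → Bool) i → h i ≡ true → 1 ≤ count h
true⇒count≥1 h zero    e rewrite e = s≤s z≤n
true⇒count≥1 h (suc i) e =
  NP.≤-trans (true⇒count≥1 (λ i → h (suc i)) i e) (NP.m≤n+m _ (indicator (h zero)))

true⇒count≥2 : ∀ {r} (h : Fin r → Bool) i j → i ≢ j → h i ≡ true → h j ≡ true → 2 ≤ count h
true⇒count≥2 h zero    zero    i≢j _  _  = E.⊥-elim (i≢j refl)
true⇒count≥2 h zero    (suc j) _   e₁ e₂ rewrite e₁ = s≤s (true⇒count≥1 (λ i → h (suc i)) j e₂)
true⇒count≥2 h (suc i) zero    _   e₁ e₂ rewrite e₂ = s≤s (true⇒count≥1 (λ i → h (suc i)) i e₁)
true⇒count≥2 h (suc i) (suc j) i≢j e₁ e₂ =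
  NP.≤-trans (true⇒count≥2 (λ i → h (suc i)) i j (λ q → i≢j (cong suc q)) e₁ e₂)
             (NP.m≤n+m _ (indicator (h zero)))

count-mono : ∀ {r} (h h′ : Fin r → Bool) → (∀ i → h i ≡ true → h′ i ≡ true) → count h ≤ count h′
count-mono {zero}  h h′ f = z≤n
count-mono {suc r} h h′ f = NP.+-mono-≤ (indicator-mono (f zero)) (count-mono _ _ (λ i → f (suc i)))

count-cong : ∀ {r} (h h′ : Fin r → Bool) → (∀ i → h i ≡ h′ i) → count h ≡ count h′
count-cong {zero}  h h′ f = refl
count-cong {suc r} h h′ f = cong₂ _+_ (cong indicator (f zero)) (count-cong _ _ (λ i → f (suc i)))

remove : ∀ {r} → (Fin r → Bool) → Fin r → Fin r → Bool
remove h z i = if does (i ≟ z) then false else h i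

count-remove : ∀ {r} (h : Fin r → Bool) z → count h ≡ indicator (h z) + count (remove h z)
count-remove {suc r} h zero    = refl
count-remove {suc r} h (suc z) =
  trans (cong (indicator (h zero) +_) (count-remove (λ i → h (suc i)) z))
        (x∙yz≈y∙xz (indicator (h zero)) (indicator (h (suc z))) _)

count-only : ∀ {r} (h : Fin r → Bool) z → (∀ i → i ≢ z → h i ≡ false) → count h ≡ indicator (h z)
count-only h z f = begin
  count h                                  ≡⟨ count-remove h z ⟩
  indicator (h z) + count (remove h z)     ≡⟨ cong (indicator (h z) +_) (count-none (remove h z) removed) ⟩
  indicator (h z) + 0                      ≡⟨ NP.+-identityʳ _ ⟩
  indicator (h z)                          ∎
  where
  open ≡-Reasoning
  removed : ∀ i → remove h z i ≡ false
  removed i with i ≟ z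
  ... | yes _   = refl
  ... | no  i≢z = f i i≢z

remove-cong : ∀ {r} (h h′ : Fin r → Bool) z → (∀ i → i ≢ z → h i ≡ h′ i)
            → ∀ i → remove h z i ≡ remove h′ z i
remove-cong h h′ z f i with i ≟ z
... | yes _   = refl
... | no  i≢z = f i i≢z

∣S∣≡count : ∀ {r} (S : Subset r) → ∣ S ∣ ≡ count (lookup S)
∣S∣≡count []          = refl
∣S∣≡count (true ∷ S)  = cong suc (∣S∣≡count S)
∣S∣≡count (false ∷ S) = ∣S∣≡count S

-- Parallel pairs of Δ_r

module Pairs (r : ℕ) where

 pair : Fin (r * 2) → Fin r
 pair = pairOf {r}

 edge : Fin r → Fin 2 → Fin (r * 2)
 edge = combine

 copy : Fin (r * 2) → Fin 2
 copy k = proj₂ (remQuot {r} 2 k)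

 pair-edge : ∀ (i : Fin r) j → pair (edge i j) ≡ i
 pair-edge i j = cong proj₁ (FP.remQuot-combine i j)

 copy-edge : ∀ (i : Fin r) j → copy (edge i j) ≡ j
 copy-edge i j = cong proj₂ (FP.remQuot-combine i j)

 edge-pair-copy : ∀ (k : Fin (r * 2)) → edge (pair k) (copy k) ≡ k
 edge-pair-copy k = FP.combine-remQuot {r} 2 k

 pair≡⇒edge : ∀ {i} k → pair k ≡ i → k ≡ edge i zero ⊎ k ≡ edge i (suc zero)
 pair≡⇒edge k refl with copy k | edge-pair-copy k
 ... | zero     | eq = inj₁ (sym eq)
 ... | suc zero | eq = inj₂ (sym eq)

 edge₀≢edge₁ : ∀ i → edge i zero ≢ edge i (suc zero)
 edge₀≢edge₁ i eq with FP.combine-injectiveʳ i zero i (suc zero) eq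
 ... | ()

 pair-has-two-edges : ∀ {i} a b c → pair a ≡ i → pair b ≡ i → pair c ≡ i → a ≢ b → a ≢ c → b ≡ c
 pair-has-two-edges a b c ea eb ec a≢b a≢c with pair≡⇒edge a ea | pair≡⇒edge b eb | pair≡⇒edge c ec
 ... | inj₁ x | inj₁ y | _      = E.⊥-elim (a≢b (trans x (sym y)))
 ... | inj₂ x | inj₂ y | _      = E.⊥-elim (a≢b (trans x (sym y)))
 ... | _      | inj₁ y | inj₁ z = trans y (sym z)
 ... | _      | inj₂ y | inj₂ z = trans y (sym z)
 ... | inj₁ x | _      | inj₁ z = E.⊥-elim (a≢c (trans x (sym z)))
 ... | inj₂ x | _      | inj₂ z = E.⊥-elim (a≢c (trans x (sym z)))

 has₀ has₁ touches fills : Subset (r * 2) → Fin r → Bool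
 has₀ X i    = lookup X (edge i zero)
 has₁ X i    = lookup X (edge i (suc zero))
 touches X i = has₀ X i ∨ has₁ X i
 fills X i   = has₀ X i ∧ has₁ X i

 #touched #filled : Subset (r * 2) → ℕ
 #touched X = count (touches X)
 #filled X  = count (fills X)

 touches-edge : ∀ X i j → edge i j ∈ X → touches X i ≡ true
 touches-edge X i zero       h = ∨-true⁺ (inj₁ (∈⇒lookup h))
 touches-edge X i (suc zero) h = ∨-true⁺ {has₀ X i} (inj₂ (∈⇒lookup h))

 touches⁺ : ∀ X k → k ∈ X → touches X (pair k) ≡ true
 touches⁺ X k h = touches-edge X (pair k) (copy k) (subst (_∈ X) (sym (edge-pair-copy k)) h)

 touches⁻ : ∀ X i → touches X i ≡ true → ∃ λ k → pair k ≡ i × k ∈ X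
 touches⁻ X i h with ∨-true⁻ (has₀ X i) h
 ... | inj₁ l = edge i zero       , pair-edge i zero       , lookup⇒∈ l
 ... | inj₂ l = edge i (suc zero) , pair-edge i (suc zero) , lookup⇒∈ l

 fills⁺ : ∀ X i → edge i zero ∈ X → edge i (suc zero) ∈ X → fills X i ≡ true
 fills⁺ X i h₀ h₁ = ∧-true⁺ (∈⇒lookup h₀) (∈⇒lookup h₁)

 fills⁻ : ∀ X i → fills X i ≡ true → ∀ k → pair k ≡ i → k ∈ X
 fills⁻ X i h k eq with pair≡⇒edge k eq
 ... | inj₁ e = subst (_∈ X) (sym e) (lookup⇒∈ (∧-trueˡ (has₀ X i) h))
 ... | inj₂ e = subst (_∈ X) (sym e) (lookup⇒∈ (∧-trueʳ (has₀ X i) h))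

 fills-two : ∀ X i k k′ → k ≢ k′ → pair k ≡ i → pair k′ ≡ i → k ∈ X → k′ ∈ X → fills X i ≡ true
 fills-two X i k k′ k≢k′ e e′ h h′ with pair≡⇒edge k e | pair≡⇒edge k′ e′
 ... | inj₁ x | inj₁ y = E.⊥-elim (k≢k′ (trans x (sym y)))
 ... | inj₂ x | inj₂ y = E.⊥-elim (k≢k′ (trans x (sym y)))
 ... | inj₁ x | inj₂ y = fills⁺ X i (subst (_∈ X) x h) (subst (_∈ X) y h′)
 ... | inj₂ x | inj₁ y = fills⁺ X i (subst (_∈ X) y h′) (subst (_∈ X) x h)

 touches-mono : ∀ X Y → X ⊆ Y → ∀ i → touches X i ≡ true → touches Y i ≡ true
 touches-mono X Y X⊆Y i h with touches⁻ X i h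
 ... | k , refl , k∈X = touches⁺ Y k (X⊆Y k∈X)

 fills-mono : ∀ X Y → X ⊆ Y → ∀ i → fills X i ≡ true → fills Y i ≡ true
 fills-mono X Y X⊆Y i h =
   fills⁺ Y i (X⊆Y (fills⁻ X i h _ (pair-edge i zero))) (X⊆Y (fills⁻ X i h _ (pair-edge i (suc zero))))

 fills⇒touches : ∀ X i → fills X i ≡ true → touches X i ≡ true
 fills⇒touches X i h = ∨-true⁺ (inj₁ (∧-trueˡ (has₀ X i) h))

 sel : Bool × Bool → Fin 2 → Bool
 sel (a , b) zero       = a
 sel (a , b) (suc zero) = b

 pairwise : (Fin r → Bool × Bool) → Subset (r * 2)
 pairwise g = tabulate (λ k → sel (g (pair k)) (copy k))

 lookup-pairwise : ∀ g i j → lookup (pairwise g) (edge i j) ≡ sel (g i) j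
 lookup-pairwise g i j =
   trans (VP.lookup∘tabulate _ (edge i j)) (cong₂ (λ a b → sel (g a) b) (pair-edge i j) (copy-edge i j))

 pairwise-⊆ : ∀ g X → (∀ i j → sel (g i) j ≡ true → edge i j ∈ X) → pairwise g ⊆ X
 pairwise-⊆ g X f {k} h = subst (_∈ X) (edge-pair-copy k) (f (pair k) (copy k) sel≡true)
   where
   sel≡true : sel (g (pair k)) (copy k) ≡ true
   sel≡true = trans (sym (VP.lookup∘tabulate _ k)) (∈⇒lookup h)

 either both : Bool × Bool → Bool
 either p = sel p zero ∨ sel p (suc zero)
 both p   = sel p zero ∧ sel p (suc zero)

 touches-pairwise : ∀ g i → touches (pairwise g) i ≡ either (g i)
 touches-pairwise g i = cong₂ _∨_ (lookup-pairwise g i zero) (lookup-pairwise g i (suc zero))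

 fills-pairwise : ∀ g i → fills (pairwise g) i ≡ both (g i)
 fills-pairwise g i = cong₂ _∧_ (lookup-pairwise g i zero) (lookup-pairwise g i (suc zero))

 lookup-pairsUnion : ∀ S i j → lookup (pairsUnion S) (edge i j) ≡ lookup S i
 lookup-pairsUnion S i j = trans (VP.lookup∘tabulate _ (edge i j)) (cong (lookup S) (pair-edge i j))

 pairsUnion⁻ : ∀ S k → k ∈ pairsUnion S → lookup S (pair k) ≡ true
 pairsUnion⁻ S k h = trans (sym (VP.lookup∘tabulate _ k)) (∈⇒lookup h)

 pairsUnion⁺ : ∀ S k → lookup S (pair k) ≡ true → k ∈ pairsUnion S
 pairsUnion⁺ S k h = lookup⇒∈ (trans (VP.lookup∘tabulate _ k) h)

 touches-pairsUnion : ∀ S i → touches (pairsUnion S) i ≡ lookup S i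
 touches-pairsUnion S i =
   trans (cong₂ _∨_ (lookup-pairsUnion S i zero) (lookup-pairsUnion S i (suc zero))) (∨-idem (lookup S i))

 fills-pairsUnion : ∀ S i → fills (pairsUnion S) i ≡ lookup S i
 fills-pairsUnion S i =
   trans (cong₂ _∧_ (lookup-pairsUnion S i zero) (lookup-pairsUnion S i (suc zero))) (∧-idem (lookup S i))

 #touched-pairsUnion : ∀ S → #touched (pairsUnion S) ≡ ∣ S ∣
 #touched-pairsUnion S = trans (count-cong _ _ (touches-pairsUnion S)) (sym (∣S∣≡count S))

 #touched-add-pair : ∀ S e → lookup S (pair e) ≡ false → #touched (pairsUnion S ∪ ⁅ e ⁆) ≡ suc ∣ S ∣
 #touched-add-pair S e S∌e = begin
   #touched Y                                                      ≡⟨ count-remove (touches Y) (pair e) ⟩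
   indicator (touches Y (pair e)) + count (remove (touches Y) (pair e))
     ≡⟨ cong₂ _+_ (cong indicator (touches⁺ Y e (SP.q⊆p∪q X ⁅ e ⁆ (SP.x∈⁅x⁆ e))))
                  (count-cong _ _ (remove-cong _ _ (pair e) touches-Y)) ⟩
   suc (count (remove (lookup S) (pair e)))
     ≡⟨ cong (λ b → suc (indicator b + count (remove (lookup S) (pair e)))) S∌e ⟨
   suc (indicator (lookup S (pair e)) + count (remove (lookup S) (pair e)))
     ≡⟨ cong suc (count-remove (lookup S) (pair e)) ⟨
   suc (count (lookup S))                                          ≡⟨ cong suc (∣S∣≡count S) ⟨
   suc ∣ S ∣                                                        ∎
   where
   open ≡-Reasoning
   X : Subset (r * 2)
   X = pairsUnion S
   Y : Subset (r * 2)
   Y = X ∪ ⁅ e ⁆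
   from-X : ∀ i → i ≢ pair e → touches Y i ≡ true → touches X i ≡ true
   from-X i i≢ie ty with touches⁻ Y i ty
   ... | k , pk , k∈Y with SP.x∈p∪q⁻ X ⁅ e ⁆ k∈Y
   ... | inj₁ k∈X = subst (λ a → touches X a ≡ true) pk (touches⁺ X k k∈X)
   ... | inj₂ k∈e = E.⊥-elim (i≢ie (trans (sym pk) (cong pair (SP.x∈⁅y⁆⇒x≡y e k∈e))))
   touches-Y : ∀ i → i ≢ pair e → touches Y i ≡ lookup S i
   touches-Y i i≢ie = trans (≡-from-≡true (from-X i i≢ie) (touches-mono X Y (SP.p⊆p∪q _) i)) (touches-pairsUnion S i)

-- Pair i consists of the adjacent entries 2i and 2i + 1 of the vector.
∣X∣≡#touched+#filled : ∀ r (X : Subset (r * 2)) → ∣ X ∣ ≡ Pairs.#touched r X + Pairs.#filled r X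
∣X∣≡#touched+#filled zero    [] = refl
∣X∣≡#touched+#filled (suc r) (true ∷ true ∷ X) =
  cong suc (trans (cong suc (∣X∣≡#touched+#filled r X)) (sym (NP.+-suc (Pairs.#touched r X) _)))
∣X∣≡#touched+#filled (suc r) (true  ∷ false ∷ X) = cong suc (∣X∣≡#touched+#filled r X)
∣X∣≡#touched+#filled (suc r) (false ∷ true  ∷ X) = cong suc (∣X∣≡#touched+#filled r X)
∣X∣≡#touched+#filled (suc r) (false ∷ false ∷ X) = ∣X∣≡#touched+#filled r X

-- The cycle of vertices

module Vertices (m : ℕ) where

 n : ℕ
 n = suc (suc m)

 R : ℕ
 R = suc n

 toℕ-next : ∀ (x : Fin R) → (suc (toℕ x) < R × toℕ (next x) ≡ suc (toℕ x))
                            ⊎ (suc (toℕ x) ≡ R × toℕ (next x) ≡ 0)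
 toℕ-next x with NP.m≤n⇒m<n∨m≡n (FP.toℕ<n x)
 ... | inj₁ lt = inj₁ (lt , trans (FP.toℕ-fromℕ< (m%n<n (suc (toℕ x)) R)) (m<n⇒m%n≡m lt))
 ... | inj₂ eq = inj₂ (eq , trans (FP.toℕ-fromℕ< (m%n<n (suc (toℕ x)) R))
                               (trans (cong (_% R) eq) (n%n≡0 R)))

 next-injective : ∀ {x y : Fin R} → next x ≡ next y → x ≡ y
 next-injective {x} {y} e with toℕ-next x | toℕ-next y
 ... | inj₁ (_ , a) | inj₁ (_ , b) = FP.toℕ-injective (NP.suc-injective (trans (sym a) (trans (cong toℕ e) b)))
 ... | inj₁ (_ , a) | inj₂ (_ , b) with () ← trans (sym a) (trans (cong toℕ e) b)
 ... | inj₂ (_ , a) | inj₁ (_ , b) with () ← trans (sym b) (trans (cong toℕ (sym e)) a)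
 ... | inj₂ (a , _) | inj₂ (b , _) = FP.toℕ-injective (NP.suc-injective (trans a (sym b)))

 next≢id : ∀ (x : Fin R) → next x ≢ x
 next≢id x e with toℕ-next x
 ... | inj₁ (_ , a) = NP.1+n≢n (trans (sym a) (cong toℕ e))
 ... | inj₂ (a , b) with trans (sym b) (cong toℕ e)
 ... | q with () ← trans (cong suc q) a

 next²≢id : ∀ (x : Fin R) → next (next x) ≢ x
 next²≢id x e with toℕ-next x | toℕ-next (next x)
 ... | inj₁ (_ , a) | inj₁ (_ , b) = NP.m≢1+n+m (toℕ x) {1} (trans (sym (cong toℕ e)) (trans b (cong suc a)))
 ... | inj₁ (_ , a) | inj₂ (c , b) with trans (sym b) (cong toℕ e)
 ... | q with () ← trans (cong (λ z → suc (suc z)) q) (trans (cong suc (sym a)) c)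
 next²≢id x e | inj₂ (c , a) | inj₁ (_ , b) with trans (sym (trans b (cong suc a))) (cong toℕ e)
 ... | q with () ← trans (cong suc q) c
 next²≢id x e | inj₂ (c , a) | inj₂ (d , b) with () ← trans (cong suc (sym a)) d

 prev : Fin R → Fin R
 prev zero    = fromℕ n
 prev (suc j) = inject₁ j

 next-prev : ∀ x → next (prev x) ≡ x
 next-prev zero with toℕ-next (fromℕ n)
 ... | inj₁ (lt , _) = E.⊥-elim (NP.<-irrefl (cong suc (FP.toℕ-fromℕ n)) lt)
 ... | inj₂ (_ , b)  = FP.toℕ-injective b
 next-prev (suc j) with toℕ-next (inject₁ j)
 ... | inj₁ (_ , b) = FP.toℕ-injective (trans b (cong suc (FP.toℕ-inject₁ j)))
 ... | inj₂ (c , _) = E.⊥-elim (FP.toℕ-inject₁-≢ j (NP.suc-injective (sym c)))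

 prev≢id : ∀ x → prev x ≢ x
 prev≢id x eq = next≢id (prev x) (trans (next-prev x) (sym eq))

 cyclic-induction : (P : Fin R → Set) (s : Fin R) → (∀ x → x ≢ s → P x → P (next x)) → P (next s)
                  → ∀ y → P y
 cyclic-induction P s step base y = everywhere
   where
   -- From next s climb to the last vertex, wrap round to 0, and climb again up to s.
   a : ℕ
   a = toℕ s
   Level : ℕ → Set
   Level k = ∀ z → toℕ z ≡ k → P z
   climb : ∀ k → k ≢ a → suc k < R → Level k → Level (suc k)
   climb k k≢a lt q z ez with toℕ-next (fromℕ< (NP.<-trans (NP.n<1+n k) lt))
   ... | inj₁ (_ , b) = subst P (FP.toℕ-injective (trans b (trans (cong suc (FP.toℕ-fromℕ< _)) (sym ez))))
                          (step _ (λ q′ → k≢a (trans (sym (FP.toℕ-fromℕ< _)) (cong toℕ q′))) (q _ (FP.toℕ-fromℕ< _)))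
   ... | inj₂ (c , _) = E.⊥-elim (NP.<-irrefl (trans (cong suc (sym (FP.toℕ-fromℕ< _))) c) lt)
   above : ∀ j → a + suc j < R → Level (a + suc j)
   above zero lt z ez with toℕ-next s
   ... | inj₁ (_ , b) = subst P (FP.toℕ-injective (trans b (trans (cong suc (sym (NP.+-identityʳ a)))
                                                          (trans (sym (NP.+-suc a 0)) (sym ez))))) base
   ... | inj₂ (c , _) = E.⊥-elim (NP.<-irrefl (trans (trans (NP.+-suc a 0) (cong suc (NP.+-identityʳ a))) c) lt)
   above (suc j) lt = subst Level (sym (NP.+-suc a (suc j)))
     (climb (a + suc j) (λ q → NP.m≢1+m+n a {j} (trans (sym q) (NP.+-suc a j)))
       (subst (_< R) (NP.+-suc a (suc j)) lt)
       (above j (NP.<-trans (NP.+-monoʳ-< a (NP.n<1+n (suc j))) lt)))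
   bottom : Level 0
   bottom with toℕ-next s
   ... | inj₂ (_ , b) = λ z ez → subst P (FP.toℕ-injective (trans b (sym ez))) base
   ... | inj₁ (lt , _) = wrap
     where
     j : ℕ
     j = n ∸ suc a
     a+1+j≡n : a + suc j ≡ n
     a+1+j≡n = trans (NP.+-suc a j) (NP.m+[n∸m]≡n (NP.≤-pred lt))
     last≢s : fromℕ n ≢ s
     last≢s q = NP.<-irrefl (sym (trans (sym (FP.toℕ-fromℕ n)) (cong toℕ q))) (NP.≤-pred lt)
     wrap : Level 0
     wrap z ez with toℕ-next (fromℕ n)
     ... | inj₁ (lt′ , _) = E.⊥-elim (NP.<-irrefl (cong suc (FP.toℕ-fromℕ n)) lt′)
     ... | inj₂ (_ , b) = subst P (FP.toℕ-injective (trans b (sym ez)))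
           (step (fromℕ n) last≢s (subst Level a+1+j≡n (above j (subst (_< R) (sym a+1+j≡n) (NP.n<1+n n)))
                                     _ (FP.toℕ-fromℕ n)))
   below : ∀ k → k ≤ a → Level k
   below zero    _  = bottom
   below (suc k) le = climb k (λ q → NP.<-irrefl q le) (NP.≤-<-trans le (FP.toℕ<n s))
                            (below k (NP.≤-trans (NP.n≤1+n k) le))
   everywhere : P y
   everywhere with NP.≤-total (toℕ y) a
   ... | inj₁ le = below (toℕ y) le y refl
   ... | inj₂ ge with NP.m≤n⇒m<n∨m≡n ge
   ... | inj₂ eq = below (toℕ y) (NP.≤-reflexive (sym eq)) y refl
   ... | inj₁ lt = above j (subst (_< R) (sym a+1+j≡y) (FP.toℕ<n y)) y (sym a+1+j≡y)
     where
     j : ℕ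
     j = toℕ y ∸ suc a
     a+1+j≡y : a + suc j ≡ toℕ y
     a+1+j≡y = trans (NP.+-suc a j) (NP.m+[n∸m]≡n lt)

-- Walks and paths in Δ_r

module Walks (m : ℕ) where
 open Vertices m public
 open Pairs R public

 G : Graph
 G = Δ R

 W : Fin R → Fin R → Set
 W = Walk G

 vs : ∀ {a b} → W a b → List (Fin R)
 vs = verts G

 es : ∀ {a b} → W a b → List (Fin (R * 2))
 es = edges G

 joins-direction : ∀ e u w → Joins G e u w → (pair e ≡ u × next u ≡ w) ⊎ (pair e ≡ w × next w ≡ u)
 joins-direction e u w (inj₁ refl) = inj₁ (refl , refl)
 joins-direction e u w (inj₂ refl) = inj₂ (refl , refl)

 joins-forward : ∀ e u → pair e ≡ u → Joins G e u (next u)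
 joins-forward e u refl = inj₁ refl

 joins-backward : ∀ e u → pair e ≡ u → Joins G e (next u) u
 joins-backward e u refl = inj₂ refl

 Forward : ∀ {a b} → W a b → Set
 Forward nil                  = Data.Unit.⊤
 Forward (cons {u} {w} e j q) = pair e ≡ u × next u ≡ w × Forward q

 Backward : ∀ {a b} → W a b → Set
 Backward nil                  = Data.Unit.⊤
 Backward (cons {u} {w} e j q) = pair e ≡ w × next w ≡ u × Backward q

 start∈verts : ∀ {a b} (p : W a b) → a LM.∈ vs p
 start∈verts nil          = here refl
 start∈verts (cons e j q) = here refl

 end∈verts : ∀ {a b} (p : W a b) → b LM.∈ vs p
 end∈verts nil          = here refl
 end∈verts (cons e j q) = there (end∈verts q)

 closed-path-trivial : ∀ {x y} (q : W x y) → x ≡ y → IsPath G q → es q ≡ [] × vs q ≡ x ∷ []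
 closed-path-trivial nil          _    _       = refl , refl
 closed-path-trivial (cons e j q) refl (a ∷ _) = E.⊥-elim (All¬⇒¬Any a (end∈verts q))

 forward-rest : ∀ {w b} (q : W w b) → IsPath G q → (∀ x → next x ≡ w → ¬ (x LM.∈ vs q)) → Forward q
 forward-rest nil _ _ = tt
 forward-rest (cons {w} {w′} e j q) (a ∷ u) h with joins-direction e w w′ j
 ... | inj₁ (pe , refl) =
   pe , refl , forward-rest q u (λ x nx≡ x∈ → All¬⇒¬Any a (subst (LM._∈ vs q) (next-injective nx≡) x∈))
 ... | inj₂ (pe , nxe)  = E.⊥-elim (h w′ nxe (there (start∈verts q)))

 backward-rest : ∀ {w b} (q : W w b) → IsPath G q → ¬ (next w LM.∈ vs q) → Backward q
 backward-rest nil _ _ = tt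
 backward-rest (cons {w} {w′} e j q) (a ∷ u) h with joins-direction e w w′ j
 ... | inj₁ (pe , refl) = E.⊥-elim (h (there (start∈verts q)))
 ... | inj₂ (pe , refl) = pe , refl , backward-rest q u (All¬⇒¬Any a)

 -- A path through the cycle of pairs cannot turn back, since that would revisit a vertex.
 path-direction : ∀ {a b} (p : W a b) → IsPath G p → Forward p ⊎ Backward p
 path-direction nil _ = inj₁ tt
 path-direction (cons {a} {w} e j q) (h ∷ u) with joins-direction e a w j
 ... | inj₁ (pe , refl) =
   inj₁ (pe , refl , forward-rest q u (λ x nx≡ x∈ → All¬⇒¬Any h (subst (LM._∈ vs q) (next-injective nx≡) x∈)))
 ... | inj₂ (pe , refl) = inj₂ (pe , refl , backward-rest q u (All¬⇒¬Any h))

 forward-successor : ∀ {a b} (q : W a b) → Forward q → ∀ {x} → x LM.∈ vs q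
                   → x ≡ b ⊎ (next x LM.∈ vs q × ∃ λ k → k LM.∈ es q × pair k ≡ x)
 forward-successor nil _ (here refl) = inj₁ refl
 forward-successor (cons e j q) (pe , refl , f) (here refl) = inj₂ (there (start∈verts q) , e , here refl , pe)
 forward-successor (cons e j q) (pe , refl , f) (there h) with forward-successor q f h
 ... | inj₁ eq                    = inj₁ eq
 ... | inj₂ (h₁ , k , k∈ , pk) = inj₂ (there h₁ , k , there k∈ , pk)

 backward-successor : ∀ {a b} (q : W a b) → Backward q → ∀ {x} → x LM.∈ vs q
                    → x ≡ a ⊎ (next x LM.∈ vs q × ∃ λ k → k LM.∈ es q × pair k ≡ x)
 backward-successor nil _ (here refl) = inj₁ refl
 backward-successor (cons e j q) _ (here refl) = inj₁ refl
 backward-successor (cons e j q) (pe , refl , f) (there h) with backward-successor q f h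
 ... | inj₁ refl                  = inj₂ (here refl , e , here refl , pe)
 ... | inj₂ (h₁ , k , k∈ , pk) = inj₂ (there h₁ , k , there k∈ , pk)

 forward-around : ∀ {a b} (p : W a b) → next b ≡ a → Forward p
                → ∀ y → y ≢ b → ∃ λ k → k LM.∈ es p × pair k ≡ y
 forward-around {a} {b} p refl f y y≢b = [ (λ y≡b → E.⊥-elim (y≢b y≡b)) , proj₂ ] (forward-successor p f (spans y))
   where
   spans : ∀ y → y LM.∈ vs p
   spans = cyclic-induction (LM._∈ vs p) b
     (λ x x≢b x∈ → [ (λ x≡b → E.⊥-elim (x≢b x≡b)) , proj₁ ] (forward-successor p f x∈)) (start∈verts p)

 backward-around : ∀ {a b} (p : W a b) → next a ≡ b → Backward p
                 → ∀ y → y ≢ a → ∃ λ k → k LM.∈ es p × pair k ≡ y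
 backward-around {a} {b} p refl f y y≢a = [ (λ y≡a → E.⊥-elim (y≢a y≡a)) , proj₂ ] (backward-successor p f (spans y))
   where
   spans : ∀ y → y LM.∈ vs p
   spans = cyclic-induction (LM._∈ vs p) a
     (λ x x≢a x∈ → [ (λ x≡a → E.⊥-elim (x≢a x≡a)) , proj₁ ] (backward-successor p f x∈)) (end∈verts p)

 forward-pair∈verts : ∀ {a b} (q : W a b) → Forward q → ∀ {k} → k LM.∈ es q → pair k LM.∈ vs q
 forward-pair∈verts (cons e j q) (pe , _ , f) (here refl) = here pe
 forward-pair∈verts (cons e j q) (pe , _ , f) (there h)   = there (forward-pair∈verts q f h)

 forward-pair≢end : ∀ {a b} (q : W a b) → Forward q → IsPath G q → ∀ {k} → k LM.∈ es q → pair k ≢ b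
 forward-pair≢end (cons e j q) (pe , _ , f) (a ∷ u) (here refl) eq =
   All¬⇒¬Any a (subst (LM._∈ vs q) (sym (trans (sym pe) eq)) (end∈verts q))
 forward-pair≢end (cons e j q) (pe , _ , f) (a ∷ u) (there h) = forward-pair≢end q f u h

 forward-pair-injective : ∀ {a b} (q : W a b) → Forward q → IsPath G q
                        → ∀ {k k′} → k LM.∈ es q → k′ LM.∈ es q → pair k ≡ pair k′ → k ≡ k′
 forward-pair-injective (cons e j q) f u (here refl) (here refl) _ = refl
 forward-pair-injective (cons e j q) (pe , _ , f) (a ∷ u) (here refl) (there h′) eq =
   E.⊥-elim (All¬⇒¬Any a (subst (LM._∈ vs q) (trans (sym eq) pe) (forward-pair∈verts q f h′)))
 forward-pair-injective (cons e j q) (pe , _ , f) (a ∷ u) (there h) (here refl) eq =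
   E.⊥-elim (All¬⇒¬Any a (subst (LM._∈ vs q) (trans eq pe) (forward-pair∈verts q f h)))
 forward-pair-injective (cons e j q) (pe , _ , f) (a ∷ u) (there h) (there h′) eq = forward-pair-injective q f u h h′ eq

 backward-pair∈verts : ∀ {a b} (q : W a b) → Backward q → ∀ {k} → k LM.∈ es q → pair k LM.∈ vs q
 backward-pair∈verts (cons e j q) (pe , _ , f) (here refl) = there (subst (LM._∈ vs q) (sym pe) (start∈verts q))
 backward-pair∈verts (cons e j q) (pe , _ , f) (there h)   = there (backward-pair∈verts q f h)

 backward-pair≢start : ∀ {a b} (q : W a b) → Backward q → IsPath G q → ∀ {k} → k LM.∈ es q → pair k ≢ a
 backward-pair≢start (cons e j q) (pe , _ , f) (a ∷ u) (here refl) eq =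
   All¬⇒¬Any a (subst (LM._∈ vs q) (trans (sym pe) eq) (start∈verts q))
 backward-pair≢start (cons e j q) (pe , _ , f) (a ∷ u) (there h) eq =
   All¬⇒¬Any a (subst (LM._∈ vs q) eq (backward-pair∈verts q f h))

 backward-pair-injective : ∀ {a b} (q : W a b) → Backward q → IsPath G q
                         → ∀ {k k′} → k LM.∈ es q → k′ LM.∈ es q → pair k ≡ pair k′ → k ≡ k′
 backward-pair-injective (cons e j q) f u (here refl) (here refl) _ = refl
 backward-pair-injective (cons e j q) (pe , _ , f) (a ∷ u) (here refl) (there h′) eq =
   E.⊥-elim (backward-pair≢start q f u h′ (trans (sym eq) pe))
 backward-pair-injective (cons e j q) (pe , _ , f) (a ∷ u) (there h) (here refl) eq =
   E.⊥-elim (backward-pair≢start q f u h (trans eq pe))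
 backward-pair-injective (cons e j q) (pe , _ , f) (a ∷ u) (there h) (there h′) eq = backward-pair-injective q f u h h′ eq

 forward-second : ∀ {u v} (p : W u v) → u ≢ v → Forward p → next u LM.∈ vs p
 forward-second nil          u≢v _              = E.⊥-elim (u≢v refl)
 forward-second (cons e j q) _   (_ , refl , _) = there (start∈verts q)

 backward-second : ∀ {u v} (p : W u v) → u ≢ v → Backward p → prev u LM.∈ vs p
 backward-second nil          u≢v _              = E.⊥-elim (u≢v refl)
 backward-second (cons {_} {w} e j q) _ (_ , nxe , _) =
   there (subst (LM._∈ vs q) (next-injective (trans nxe (sym (next-prev _)))) (start∈verts q))

 IsSingleEdge : ∀ {a b} → W a b → Fin R → Set
 IsSingleEdge p i = ∃ λ k → es p ≡ k ∷ [] × pair k ≡ i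

 forward-single-edge : ∀ {u v} (p : W u v) → next u ≡ v → Forward p → IsPath G p
                     → IsSingleEdge p u × vs p ≡ u ∷ v ∷ []
 forward-single-edge nil eq _ _ = E.⊥-elim (next≢id _ eq)
 forward-single-edge (cons e j q) eq (pe , refl , _) (_ ∷ uq) with closed-path-trivial q eq uq
 ... | es≡ , vs≡ = (e , cong (e ∷_) es≡ , pe) , cong (_ ∷_) (trans vs≡ (cong (_∷ []) eq))

 backward-single-edge : ∀ {u v} (p : W u v) → next v ≡ u → Backward p → IsPath G p
                      → IsSingleEdge p v × vs p ≡ u ∷ v ∷ []
 backward-single-edge nil eq _ _ = E.⊥-elim (next≢id _ eq)
 backward-single-edge (cons e j q) eq (pe , nxe , _) (_ ∷ uq) with closed-path-trivial q (next-injective (trans nxe (sym eq))) uq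
 ... | es≡ , vs≡ = (e , cong (e ∷_) es≡ , trans pe (next-injective (trans nxe (sym eq))))
                 , cong (_ ∷_) (trans vs≡ (cong (_∷ []) (next-injective (trans nxe (sym eq)))))

 TransversalList : List (Fin (R * 2)) → Set
 TransversalList l = (∀ y → ∃ λ k → k LM.∈ l × pair k ≡ y)
                   × (∀ {k k′} → k LM.∈ l → k′ LM.∈ l → pair k ≡ pair k′ → k ≡ k′)

 PairList : List (Fin (R * 2)) → Fin R → Set
 PairList l i = (∀ {k} → k LM.∈ l → pair k ≡ i) × (∀ k → pair k ≡ i → k LM.∈ l)

 CycleShape : List (Fin (R * 2)) → List (Fin R) → Set
 CycleShape l V = (∃ λ i → PairList l i × (∀ x → x LM.∈ V → x ≡ i ⊎ x ≡ next i)) ⊎ TransversalList l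

 digon-shape : ∀ {e k i V} → pair e ≡ i → pair k ≡ i → e ≢ k → (∀ x → x LM.∈ V → x ≡ i ⊎ x ≡ next i)
             → CycleShape (e ∷ k ∷ []) V
 digon-shape {e} {k} {i} pe pk e≢k V-ends = inj₁ (i , (in-pair , all-of-pair) , V-ends)
   where
   in-pair : ∀ {x} → x LM.∈ (e ∷ k ∷ []) → pair x ≡ i
   in-pair (here refl)         = pe
   in-pair (there (here refl)) = pk
   all-of-pair : ∀ x → pair x ≡ i → x LM.∈ (e ∷ k ∷ [])
   all-of-pair x px with x ≟ e | x ≟ k
   ... | yes x≡e | _       = here x≡e
   ... | no  _   | yes x≡k = there (here x≡k)
   ... | no  x≢e | no  x≢k = E.⊥-elim (e≢k (pair-has-two-edges x e k px pe pk x≢e x≢k))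

 transversal-cons : ∀ {e l i} → pair e ≡ i → (∀ y → y ≢ i → ∃ λ k → k LM.∈ l × pair k ≡ y)
                  → (∀ {k} → k LM.∈ l → pair k ≢ i)
                  → (∀ {k k′} → k LM.∈ l → k′ LM.∈ l → pair k ≡ pair k′ → k ≡ k′)
                  → TransversalList (e ∷ l)
 transversal-cons {e} {l} {i} pe around l∌i l-injective = covers , injective
   where
   covers : ∀ y → ∃ λ k → k LM.∈ (e ∷ l) × pair k ≡ y
   covers y with y ≟ i
   ... | yes refl = e , here refl , pe
   ... | no  y≢i  with around y y≢i
   ... | k , k∈ , pk = k , there k∈ , pk
   injective : ∀ {k k′} → k LM.∈ (e ∷ l) → k′ LM.∈ (e ∷ l) → pair k ≡ pair k′ → k ≡ k′
   injective (here refl) (here refl) _  = refl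
   injective (here refl) (there h′)  eq = E.⊥-elim (l∌i h′ (trans (sym eq) pe))
   injective (there h)   (here refl) eq = E.⊥-elim (l∌i h (trans eq pe))
   injective (there h)   (there h′)  eq = l-injective h h′ eq

 cycle-shape-list : ∀ u w e → Joins G e u w → (p : W w u) → IsPath G p → ¬ (e LM.∈ es p)
                  → CycleShape (e ∷ es p) (vs p)
 cycle-shape-list u w e j p p-path e∉p with joins-direction e u w j | path-direction p p-path
 ... | inj₁ (pe , refl) | inj₁ fp =
   inj₂ (transversal-cons pe (forward-around p refl fp) (forward-pair≢end p fp p-path) (forward-pair-injective p fp p-path))
 ... | inj₂ (pe , refl) | inj₂ bp =
   inj₂ (transversal-cons pe (backward-around p refl bp) (backward-pair≢start p bp p-path) (backward-pair-injective p bp p-path))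
 ... | inj₁ (pe , refl) | inj₂ bp with backward-single-edge p refl bp p-path
 ... | (k , es≡ , pk) , vs≡ rewrite es≡ | vs≡ =
   digon-shape pe pk (λ e≡k → e∉p (here e≡k)) λ { _ (here refl) → inj₂ refl ; _ (there (here refl)) → inj₁ refl }
 cycle-shape-list u w e j p p-path e∉p | inj₂ (pe , refl) | inj₁ fp with forward-single-edge p refl fp p-path
 ... | (k , es≡ , pk) , vs≡ rewrite es≡ | vs≡ =
   digon-shape pe pk (λ e≡k → e∉p (here e≡k)) λ { _ (here refl) → inj₁ refl ; _ (there (here refl)) → inj₂ refl }

 IsPair : Subset (R * 2) → Fin R → Set
 IsPair C i = (∀ {k} → k ∈ C → pair k ≡ i) × (∀ k → pair k ≡ i → k ∈ C)

 IsTransversal : Subset (R * 2) → Set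
 IsTransversal C = (∀ y → ∃ λ k → k ∈ C × pair k ≡ y)
                 × (∀ {k k′} → k ∈ C → k′ ∈ C → pair k ≡ pair k′ → k ≡ k′)

 transversalList⇒ : ∀ l → TransversalList l → IsTransversal (listToSet l)
 transversalList⇒ l (covers , injective) =
   (λ y → let (k , k∈ , pk) = covers y in k , ∈⇒∈listToSet l k∈ , pk) ,
   (λ h h′ eq → injective (∈listToSet⇒∈ l h) (∈listToSet⇒∈ l h′) eq)

 cycle-shape : ∀ C → IsCycle G C → (∃ λ i → IsPair C i) ⊎ IsTransversal C
 cycle-shape C (c , refl) with cycle-shape-list u w e joins path isPath fresh
   where open CycleW c
 ... | inj₁ (i , (f , g) , _) = inj₁ (i , (λ h → f (∈listToSet⇒∈ _ h)) , (λ k pk → ∈⇒∈listToSet _ (g k pk)))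
 ... | inj₂ tl                = inj₂ (transversalList⇒ _ tl)

 hamiltonian⇒transversal : ∀ C → IsHamCycle G C → IsTransversal C
 hamiltonian⇒transversal C (c , refl , spanning) with cycle-shape-list u w e joins path isPath fresh
   where open CycleW c
 ... | inj₂ tl = transversalList⇒ _ tl
 ... | inj₁ (i , _ , ends) with ends (next (next i)) (spanning (next (next i)))
 ... | inj₁ eq = E.⊥-elim (next²≢id i eq)
 ... | inj₂ eq = E.⊥-elim (next≢id i (next-injective eq))

 -- Theta-subgraphs

 ThetaShape : Subset (R * 2) → Set
 ThetaShape T = ∃ λ i → fills T i ≡ true × (∀ y → touches T y ≡ true)

 module ThetaShapeOf (t : ThetaW G) where
  open ThetaW t
  T : Subset (R * 2)
  T = thetaEdges G t

  path⊆theta : ∀ a {k} → k LM.∈ es (P a) → k ∈ T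
  path⊆theta zero             h = SP.p⊆p∪q _ (∈⇒∈listToSet _ h)
  path⊆theta (suc zero)       h = SP.q⊆p∪q (listToSet (es (P zero))) _ (SP.p⊆p∪q _ (∈⇒∈listToSet _ h))
  path⊆theta (suc (suc zero)) h =
    SP.q⊆p∪q (listToSet (es (P zero))) _ (SP.q⊆p∪q (listToSet (es (P (suc zero)))) _ (∈⇒∈listToSet _ h))

  the-edge : ∀ {a k} → es (P a) ≡ k ∷ [] → k LM.∈ es (P a)
  the-edge eq = subst (_ LM.∈_) (sym eq) (here refl)

  single-edges-distinct : ∀ {a b i j} → a ≢ b → ((k , _) : IsSingleEdge (P a) i) → ((k′ , _) : IsSingleEdge (P b) j)
                        → k ≢ k′
  single-edges-distinct {a} {b} a≢b (k , ea , _) (k′ , eb , _) refl = edgeDisj a b a≢b k (the-edge ea) (the-edge eb)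

  two-single-edges-fill : ∀ {a b i} → a ≢ b → IsSingleEdge (P a) i → IsSingleEdge (P b) i → fills T i ≡ true
  two-single-edges-fill {a} {b} a≢b sa@(k , ea , pk) sb@(k′ , eb , pk′) =
    fills-two T _ k k′ (single-edges-distinct a≢b sa sb) pk pk′ (path⊆theta a (the-edge ea)) (path⊆theta b (the-edge eb))

  no-three-single-edges : ∀ {a b c i} → a ≢ b → a ≢ c → b ≢ c
                        → IsSingleEdge (P a) i → IsSingleEdge (P b) i → IsSingleEdge (P c) i → E.⊥
  no-three-single-edges a≢b a≢c b≢c sa@(_ , _ , pa) sb@(_ , _ , pb) sc@(_ , _ , pc) =
    single-edges-distinct b≢c sb sc
      (pair-has-two-edges _ _ _ pa pb pc (single-edges-distinct a≢b sa sb) (single-edges-distinct a≢c sa sc))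

  full-and-around : ∀ {c i} → fills T i ≡ true → (∀ y → y ≢ i → ∃ λ k → k LM.∈ es (P c) × pair k ≡ y)
                  → ThetaShape T
  full-and-around {c} {i} full around = i , full , touched
    where
    touched : ∀ y → touches T y ≡ true
    touched y with y ≟ i
    ... | yes refl = fills⇒touches T i full
    ... | no  y≢i  with around y y≢i
    ... | k , k∈ , refl = touches⁺ T k (path⊆theta c k∈)

  two-forward : ∀ a b c → a ≢ b → a ≢ c → b ≢ c → Forward (P a) → Forward (P b) → ThetaShape T
  two-forward a b c a≢b a≢c b≢c fa fb = third (path-direction (P c) (paths c))
    where
    next-u≡v : next u ≡ v
    next-u≡v with intDisj a b a≢b (next u) (forward-second (P a) u≢v fa) (forward-second (P b) u≢v fb)
    ... | inj₁ eq = E.⊥-elim (next≢id u eq)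
    ... | inj₂ eq = eq
    single : ∀ x → Forward (P x) → IsSingleEdge (P x) u
    single x fx = proj₁ (forward-single-edge (P x) next-u≡v fx (paths x))
    third : Forward (P c) ⊎ Backward (P c) → ThetaShape T
    third (inj₁ fc) = E.⊥-elim (no-three-single-edges a≢b a≢c b≢c (single a fa) (single b fb) (single c fc))
    third (inj₂ bc) = full-and-around (two-single-edges-fill a≢b (single a fa) (single b fb))
                                      (backward-around (P c) next-u≡v bc)

  two-backward : ∀ a b c → a ≢ b → a ≢ c → b ≢ c → Backward (P a) → Backward (P b) → ThetaShape T
  two-backward a b c a≢b a≢c b≢c ba bb = third (path-direction (P c) (paths c))
    where
    next-v≡u : next v ≡ u
    next-v≡u with intDisj a b a≢b (prev u) (backward-second (P a) u≢v ba) (backward-second (P b) u≢v bb)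
    ... | inj₁ eq = E.⊥-elim (prev≢id u eq)
    ... | inj₂ eq = trans (cong next (sym eq)) (next-prev u)
    single : ∀ x → Backward (P x) → IsSingleEdge (P x) v
    single x bx = proj₁ (backward-single-edge (P x) next-v≡u bx (paths x))
    third : Forward (P c) ⊎ Backward (P c) → ThetaShape T
    third (inj₂ bc) = E.⊥-elim (no-three-single-edges a≢b a≢c b≢c (single a ba) (single b bb) (single c bc))
    third (inj₁ fc) = full-and-around (two-single-edges-fill a≢b (single a ba) (single b bb))
                                      (forward-around (P c) next-v≡u fc)

  -- Two of the three paths run in the same direction.
  shape : ThetaShape T
  shape with path-direction (P zero) (paths zero) | path-direction (P (suc zero)) (paths (suc zero))
           | path-direction (P (suc (suc zero))) (paths (suc (suc zero)))
  ... | inj₁ f₀ | inj₁ f₁ | _       = two-forward  zero (suc zero) (suc (suc zero)) (λ ()) (λ ()) (λ ()) f₀ f₁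
  ... | inj₂ b₀ | inj₂ b₁ | _       = two-backward zero (suc zero) (suc (suc zero)) (λ ()) (λ ()) (λ ()) b₀ b₁
  ... | inj₁ f₀ | inj₂ _  | inj₁ f₂ = two-forward  zero (suc (suc zero)) (suc zero) (λ ()) (λ ()) (λ ()) f₀ f₂
  ... | inj₂ b₀ | inj₁ _  | inj₂ b₂ = two-backward zero (suc (suc zero)) (suc zero) (λ ()) (λ ()) (λ ()) b₀ b₂
  ... | inj₁ _  | inj₂ b₁ | inj₂ b₂ = two-backward (suc zero) (suc (suc zero)) zero (λ ()) (λ ()) (λ ()) b₁ b₂
  ... | inj₂ _  | inj₁ f₁ | inj₁ f₂ = two-forward  (suc zero) (suc (suc zero)) zero (λ ()) (λ ()) (λ ()) f₁ f₂

 theta-shape : ∀ T → IsTheta G T → ThetaShape T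
 theta-shape T (t , refl) = ThetaShapeOf.shape t

 -- Circuits

 pairSet : Fin R → Subset (R * 2)
 pairSet i = pairsUnion ⁅ i ⁆

 pairSet-isPair : ∀ i → IsPair (pairSet i) i
 pairSet-isPair i = (λ {k} h → SP.x∈⁅y⁆⇒x≡y i (lookup⇒∈ (pairsUnion⁻ ⁅ i ⁆ k h)))
                  , (λ k pk → pairsUnion⁺ ⁅ i ⁆ k (trans (cong (lookup ⁅ i ⁆) pk) (∈⇒lookup (SP.x∈⁅x⁆ i))))

 pair-not-transversal : ∀ C i → IsPair C i → IsTransversal C → E.⊥
 pair-not-transversal C i (in-pair , _) (covers , _) with covers (next i)
 ... | k , k∈ , pk = next≢id i (trans (sym pk) (in-pair k∈))

 pairSet-isCycle : ∀ i → IsCycle G (pairSet i)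
 pairSet-isCycle i = digon , SP.⊆-antisym digon⊆ ⊆digon
   where
   e₀ = edge i zero
   e₁ = edge i (suc zero)
   digon : CycleW G
   digon = record { u = i ; w = next i ; e = e₀ ; joins = joins-forward e₀ i (pair-edge i zero)
                  ; path = cons e₁ (joins-backward e₁ i (pair-edge i (suc zero))) nil
                  ; isPath = (next≢id i ∷ []) ∷ [] ∷ []
                  ; fresh = λ { (here eq) → edge₀≢edge₁ i eq } }
   digon⊆ : cycleEdges G digon ⊆ pairSet i
   digon⊆ h with ∈listToSet⇒∈ (e₀ ∷ e₁ ∷ []) h
   ... | here refl         = proj₂ (pairSet-isPair i) _ (pair-edge i zero)
   ... | there (here refl) = proj₂ (pairSet-isPair i) _ (pair-edge i (suc zero))
   ⊆digon : pairSet i ⊆ cycleEdges G digon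
   ⊆digon {k} h with pair≡⇒edge k (proj₁ (pairSet-isPair i) h)
   ... | inj₁ refl = ∈⇒∈listToSet (e₀ ∷ e₁ ∷ []) (here refl)
   ... | inj₂ refl = ∈⇒∈listToSet (e₀ ∷ e₁ ∷ []) (there (here refl))

 vert-isPair : ∀ C i x → IsPair C i → VertOf G C x → x ≡ i ⊎ x ≡ next i
 vert-isPair C i x (in-pair , _) (k , k∈ , inj₁ eq) = inj₁ (trans (sym eq) (in-pair k∈))
 vert-isPair C i x (in-pair , _) (k , k∈ , inj₂ eq) = inj₂ (trans (sym eq) (cong next (in-pair k∈)))

 vert-transversal : ∀ C x → IsTransversal C → VertOf G C x
 vert-transversal C x (covers , _) with covers x
 ... | k , k∈ , pk = k , k∈ , inj₁ pk

 common-end : ∀ {i j x} → i ≢ j → x ≡ i ⊎ x ≡ next i → x ≡ j ⊎ x ≡ next j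
            → (x ≡ i × i ≡ next j) ⊎ (x ≡ j × j ≡ next i)
 common-end i≢j (inj₁ a) (inj₁ b) = E.⊥-elim (i≢j (trans (sym a) b))
 common-end i≢j (inj₁ a) (inj₂ b) = inj₁ (a , trans (sym a) b)
 common-end i≢j (inj₂ a) (inj₁ b) = inj₂ (b , trans (sym b) a)
 common-end i≢j (inj₂ a) (inj₂ b) = E.⊥-elim (i≢j (next-injective (trans (sym a) b)))

 pairs-share-one-vertex : ∀ {i j} → i ≢ j → ∀ x y → (x ≡ i ⊎ x ≡ next i) → (x ≡ j ⊎ x ≡ next j)
                        → (y ≡ i ⊎ y ≡ next i) → (y ≡ j ⊎ y ≡ next j) → x ≡ y
 pairs-share-one-vertex {i} i≢j x y xi xj yi yj with common-end i≢j xi xj | common-end i≢j yi yj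
 ... | inj₁ (p , _) | inj₁ (q , _) = trans p (sym q)
 ... | inj₂ (p , _) | inj₂ (q , _) = trans p (sym q)
 ... | inj₁ (_ , p) | inj₂ (_ , q) = E.⊥-elim (next²≢id i (trans (cong next (sym q)) (sym p)))
 ... | inj₂ (_ , q) | inj₁ (_ , p) = E.⊥-elim (next²≢id i (trans (cong next (sym q)) (sym p)))

 module BackwardAround (c : Fin R → Fin (R * 2)) (pair-c : ∀ y → pair (c y) ≡ y) (i : Fin R) where

  -- x lies d steps before i on the cycle
  Behind : Fin R → ℕ → Set
  Behind x d = toℕ x + d ≡ toℕ i ⊎ toℕ x + d ≡ toℕ i + R

  behind-prev : ∀ x d → Behind x d → suc d < R → Behind (prev x) (suc d)
  behind-prev (suc j) d (inj₁ e) _ = inj₁ (trans (cong (_+ suc d) (FP.toℕ-inject₁ j)) (trans (NP.+-suc (toℕ j) d) e))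
  behind-prev (suc j) d (inj₂ e) _ = inj₂ (trans (cong (_+ suc d) (FP.toℕ-inject₁ j)) (trans (NP.+-suc (toℕ j) d) e))
  behind-prev zero d (inj₁ e) _ = inj₂ (begin
    toℕ (fromℕ n) + suc d ≡⟨ cong (_+ suc d) (FP.toℕ-fromℕ n) ⟩
    n + suc d             ≡⟨ NP.+-suc n d ⟩
    suc (n + d)           ≡⟨ cong suc (NP.+-comm n d) ⟩
    suc (d + n)           ≡⟨ NP.+-suc d n ⟨
    d + R                 ≡⟨ cong (_+ R) e ⟩
    toℕ i + R             ∎)
    where open ≡-Reasoning
  behind-prev zero d (inj₂ e) lt =
    E.⊥-elim (NP.<⇒≱ (NP.<-trans (NP.n<1+n d) lt) (subst (R ≤_) (sym e) (NP.m≤n+m R (toℕ i))))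

  behind-unique : ∀ x d d′ → Behind x d → Behind x d′ → d < R → d′ < R → d ≡ d′
  behind-unique x d d′ (inj₁ a) (inj₁ b) _ _  = NP.+-cancelˡ-≡ (toℕ x) d d′ (trans a (sym b))
  behind-unique x d d′ (inj₂ a) (inj₂ b) _ _  = NP.+-cancelˡ-≡ (toℕ x) d d′ (trans a (sym b))
  behind-unique x d d′ (inj₁ a) (inj₂ b) _ d′<R = E.⊥-elim (NP.<⇒≱ d′<R (subst (R ≤_) d′≡d+R (NP.m≤n+m R d)))
    where
    d′≡d+R : d + R ≡ d′
    d′≡d+R = NP.+-cancelˡ-≡ (toℕ x) _ _ (trans (sym (NP.+-assoc (toℕ x) d R)) (trans (cong (_+ R) a) (sym b)))
  behind-unique x d d′ (inj₂ a) (inj₁ b) d<R d′<R = sym (behind-unique x d′ d (inj₁ b) (inj₂ a) d′<R d<R)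

  behind-n : ∀ x → Behind x n → x ≡ next i
  behind-n x (inj₁ a) with toℕ-next i
  ... | inj₁ (lt , _) = E.⊥-elim (NP.<⇒≱ (NP.≤-pred lt) (subst (n ≤_) a (NP.m≤n+m n (toℕ x))))
  ... | inj₂ (_ , b)  = FP.toℕ-injective (trans x≡0 (sym b))
    where
    x≡0 : toℕ x ≡ 0
    x≡0 = NP.n≤0⇒n≡0 (NP.+-cancelʳ-≤ n (toℕ x) 0 (subst (_≤ n) (sym a) (NP.≤-pred (FP.toℕ<n i))))
  behind-n x (inj₂ a) with toℕ-next i
  ... | inj₁ (_ , b)  = FP.toℕ-injective (trans x≡1+i (sym b))
    where
    x≡1+i : toℕ x ≡ suc (toℕ i)
    x≡1+i = NP.+-cancelʳ-≡ n _ _ (trans a (NP.+-suc (toℕ i) n))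
  ... | inj₂ (c′ , _) = E.⊥-elim (NP.<-irrefl (trans x≡1+i c′) (FP.toℕ<n x))
    where
    x≡1+i : toℕ x ≡ suc (toℕ i)
    x≡1+i = NP.+-cancelʳ-≡ n _ _ (trans a (NP.+-suc (toℕ i) n))

  step-joins : ∀ x → Joins G (c (prev x)) x (prev x)
  step-joins x = subst (λ z → Joins G (c (prev x)) z (prev x)) (next-prev x)
                       (joins-backward (c (prev x)) (prev x) (pair-c (prev x)))

  at-end : ∀ x d → Behind x d → d + 0 ≡ n → x ≡ next i
  at-end x d h e = behind-n x (subst (Behind x) (trans (sym (NP.+-identityʳ d)) e) h)

  not-yet : ∀ d k → d + suc k ≡ n → suc d < R
  not-yet d k e = s≤s (subst (suc d ≤_) (trans (sym (NP.+-suc d k)) e) (s≤s (NP.m≤m+n d k)))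

  walk : (k : ℕ) (x : Fin R) (d : ℕ) → Behind x d → d + k ≡ n → W x (next i)
  walk zero x d h e with at-end x d h e
  ... | refl = nil
  walk (suc k) x d h e = cons (c (prev x)) (step-joins x)
    (walk k (prev x) (suc d) (behind-prev x d h (not-yet d k e)) (trans (sym (NP.+-suc d k)) e))

  walk-backward : ∀ k x d h e → Backward (walk k x d h e)
  walk-backward zero x d h e with at-end x d h e
  ... | refl = tt
  walk-backward (suc k) x d h e = pair-c (prev x) , next-prev x , walk-backward k (prev x) (suc d) _ _

  walk-chosen : ∀ k x d h e {k′} → k′ LM.∈ es (walk k x d h e) → k′ ≡ c (pair k′)
  walk-chosen zero x d h e k′∈ with at-end x d h e
  walk-chosen zero x d h e () | refl
  walk-chosen (suc k) x d h e (here refl) = cong c (sym (pair-c (prev x)))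
  walk-chosen (suc k) x d h e (there k′∈) = walk-chosen k (prev x) (suc d) _ _ k′∈

  walk-verts-behind : ∀ k x d h e {y} → y LM.∈ vs (walk k x d h e) → ∃ λ d′ → Behind y d′ × d ≤ d′ × d′ ≤ n
  walk-verts-behind zero x d h e y∈ with at-end x d h e
  walk-verts-behind zero x d h e (here refl) | refl = d , h , NP.≤-refl , NP.≤-reflexive (trans (sym (NP.+-identityʳ d)) e)
  walk-verts-behind (suc k) x d h e (here refl) = d , h , NP.≤-refl , subst (d ≤_) e (NP.m≤m+n d (suc k))
  walk-verts-behind (suc k) x d h e (there y∈) with walk-verts-behind k (prev x) (suc d) _ _ y∈
  ... | d′ , h′ , d<d′ , d′≤n = d′ , h′ , NP.≤-trans (NP.n≤1+n d) d<d′ , d′≤n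

  walk-isPath : ∀ k x d h e → IsPath G (walk k x d h e)
  walk-isPath zero x d h e with at-end x d h e
  ... | refl = [] ∷ []
  walk-isPath (suc k) x d h e = All.tabulate x∉rest ∷ walk-isPath k (prev x) (suc d) _ _
    where
    x∉rest : ∀ {y} → y LM.∈ vs (walk k (prev x) (suc d) _ _) → x ≢ y
    x∉rest y∈ refl with walk-verts-behind k (prev x) (suc d) _ _ y∈
    ... | d′ , h′ , d<d′ , d′≤n =
      NP.<-irrefl (behind-unique x d d′ h h′ (s≤s (subst (d ≤_) e (NP.m≤m+n d (suc k)))) (s≤s d′≤n)) d<d′

  path : W i (next i)
  path = walk n i 0 (inj₁ (NP.+-identityʳ (toℕ i))) refl

 module ThetaOfFullPair (I : Subset (R * 2)) (i : Fin R) (full : fills I i ≡ true)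
                        (spanning : ∀ y → touches I y ≡ true) (only-full : ∀ y → y ≢ i → fills I y ≡ false) where

  c : Fin R → Fin (R * 2)
  c y = if has₀ I y then edge y zero else edge y (suc zero)

  pair-c : ∀ y → pair (c y) ≡ y
  pair-c y with has₀ I y
  ... | true  = pair-edge y zero
  ... | false = pair-edge y (suc zero)

  c∈I : ∀ y → c y ∈ I
  c∈I y with has₀ I y in eq | spanning y
  ... | true  | _ = lookup⇒∈ eq
  ... | false | h = lookup⇒∈ h

  I-chosen : ∀ k → k ∈ I → pair k ≢ i → k ≡ c (pair k)
  I-chosen k k∈ pk≢i with pair≡⇒edge k refl | has₀ I (pair k) in eq
  ... | inj₁ e | true  = e
  ... | inj₁ e | false = E.⊥-elim (true≢false (trans (sym (∈⇒lookup (subst (_∈ I) e k∈))) eq))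
  ... | inj₂ e | false = e
  ... | inj₂ e | true  =
    E.⊥-elim (true≢false (trans (sym (fills⁺ I (pair k) (lookup⇒∈ eq) (subst (_∈ I) e k∈))) (only-full _ pk≢i)))

  open BackwardAround c pair-c i

  around : W i (next i)
  around = path

  around-backward : Backward around
  around-backward = walk-backward n i 0 _ _

  around-isPath : IsPath G around
  around-isPath = walk-isPath n i 0 _ _

  around⊆I : ∀ {k} → k LM.∈ es around → k ∈ I
  around⊆I {k} k∈ = subst (_∈ I) (sym (walk-chosen n i 0 _ _ k∈)) (c∈I (pair k))

  around-avoids-i : ∀ {k} → k LM.∈ es around → pair k ≢ i
  around-avoids-i = backward-pair≢start around around-backward around-isPath

  e₀ e₁ : Fin (R * 2)
  e₀ = edge i zero
  e₁ = edge i (suc zero)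

  paths : Fin 3 → W i (next i)
  paths zero             = cons e₀ (joins-forward e₀ i (pair-edge i zero)) nil
  paths (suc zero)       = cons e₁ (joins-forward e₁ i (pair-edge i (suc zero))) nil
  paths (suc (suc zero)) = around

  paths-isPath : ∀ a → IsPath G (paths a)
  paths-isPath zero             = (next≢id i ∘ sym ∷ []) ∷ [] ∷ []
  paths-isPath (suc zero)       = (next≢id i ∘ sym ∷ []) ∷ [] ∷ []
  paths-isPath (suc (suc zero)) = around-isPath

  ends : ∀ {x} → x LM.∈ (i ∷ next i ∷ []) → x ≡ i ⊎ x ≡ next i
  ends (here eq)         = inj₁ eq
  ends (there (here eq)) = inj₂ eq

  internally-disjoint : ∀ a b → a ≢ b → ∀ x → x LM.∈ vs (paths a) → x LM.∈ vs (paths b) → x ≡ i ⊎ x ≡ next i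
  internally-disjoint zero             _                _   x x∈ _  = ends x∈
  internally-disjoint (suc zero)       _                _   x x∈ _  = ends x∈
  internally-disjoint (suc (suc zero)) zero             _   x _  x∈ = ends x∈
  internally-disjoint (suc (suc zero)) (suc zero)       _   x _  x∈ = ends x∈
  internally-disjoint (suc (suc zero)) (suc (suc zero)) a≢b _ _ _   = E.⊥-elim (a≢b refl)

  the-only : ∀ {k k′ : Fin (R * 2)} → k LM.∈ (k′ ∷ []) → k ≡ k′
  the-only (here eq) = eq

  edge-disjoint : ∀ a b → a ≢ b → ∀ k → k LM.∈ es (paths a) → k LM.∈ es (paths b) → E.⊥
  edge-disjoint zero             zero             a≢b _ _  _  = a≢b refl
  edge-disjoint (suc zero)       (suc zero)       a≢b _ _  _  = a≢b refl
  edge-disjoint (suc (suc zero)) (suc (suc zero)) a≢b _ _  _  = a≢b refl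
  edge-disjoint zero             (suc zero)       _   _ ha hb = edge₀≢edge₁ i (trans (sym (the-only ha)) (the-only hb))
  edge-disjoint (suc zero)       zero             _   _ ha hb = edge₀≢edge₁ i (trans (sym (the-only hb)) (the-only ha))
  edge-disjoint zero             (suc (suc zero)) _   _ ha hb = around-avoids-i hb (trans (cong pair (the-only ha)) (pair-edge i zero))
  edge-disjoint (suc zero)       (suc (suc zero)) _   _ ha hb = around-avoids-i hb (trans (cong pair (the-only ha)) (pair-edge i (suc zero)))
  edge-disjoint (suc (suc zero)) zero             _   _ ha hb = around-avoids-i ha (trans (cong pair (the-only hb)) (pair-edge i zero))
  edge-disjoint (suc (suc zero)) (suc zero)       _   _ ha hb = around-avoids-i ha (trans (cong pair (the-only hb)) (pair-edge i (suc zero)))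

  theta : ThetaW G
  theta = record { u = i ; v = next i ; u≢v = next≢id i ∘ sym ; P = paths ; paths = paths-isPath
                 ; intDisj = internally-disjoint ; edgeDisj = edge-disjoint }

  theta⊆I : thetaEdges G theta ⊆ I
  theta⊆I h with SP.x∈p∪q⁻ _ _ h
  ... | inj₁ h₀ = subst (_∈ I) (sym (the-only (∈listToSet⇒∈ (es (paths zero)) h₀)))
                        (fills⁻ I i full e₀ (pair-edge i zero))
  ... | inj₂ h′ with SP.x∈p∪q⁻ _ _ h′
  ... | inj₁ h₁ = subst (_∈ I) (sym (the-only (∈listToSet⇒∈ (es (paths (suc zero))) h₁)))
                        (fills⁻ I i full e₁ (pair-edge i (suc zero)))
  ... | inj₂ h₂ = around⊆I (∈listToSet⇒∈ (es around) h₂)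

  I⊆theta : I ⊆ thetaEdges G theta
  I⊆theta {k} k∈ with pair k ≟ i
  ... | yes pk with pair≡⇒edge k pk
  ... | inj₁ refl = ThetaShapeOf.path⊆theta theta zero (here refl)
  ... | inj₂ refl = ThetaShapeOf.path⊆theta theta (suc zero) (here refl)
  I⊆theta {k} k∈ | no pk≢i with backward-around around refl around-backward (pair k) pk≢i
  ... | k′ , k′∈ , pk′ = ThetaShapeOf.path⊆theta theta (suc (suc zero)) (subst (LM._∈ es around) k′≡k k′∈)
    where
    k′≡k : k′ ≡ k
    k′≡k = trans (walk-chosen n i 0 _ _ k′∈) (trans (cong c pk′) (sym (I-chosen k k∈ pk≢i)))

  circuit : ∀ B → ¬ B (pairSet i) → LiftCircuit G B I
  circuit B unbalanced = inj₂ (inj₁ ((theta , SP.⊆-antisym theta⊆I I⊆theta) , pairSet i , pairSet-isCycle i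
                                    , (λ {k} h → fills⁻ I i full k (proj₁ (pairSet-isPair i) h)) , unbalanced))

-- The lift matroid

module LiftMatroid (m : ℕ) (B : Subset (suc (suc (suc m)) * 2) → Set)
                   (B-hamiltonian : ∀ C → B C → IsHamCycle (Δ (suc (suc (suc m)))) C) where
 open Walks m

 Circuit : Subset (R * 2) → Set
 Circuit = LiftCircuit G B

 Indep : Subset (R * 2) → Set
 Indep = Independent Circuit

 balanced⇒transversal : ∀ C → B C → IsTransversal C
 balanced⇒transversal C b = hamiltonian⇒transversal C (B-hamiltonian C b)

 pairSet-unbalanced : ∀ i → ¬ B (pairSet i)
 pairSet-unbalanced i b = pair-not-transversal (pairSet i) i (pairSet-isPair i) (balanced⇒transversal (pairSet i) b)

 handcuff : ∀ i j → i ≢ j → Circuit (pairSet i ∪ pairSet j)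
 handcuff i j i≢j = inj₂ (inj₂ (pairSet i , pairSet j , pairSet-isCycle i , pairSet-isCycle j
                               , pairSet-unbalanced i , pairSet-unbalanced j , pairSet-distinct , share-one , refl))
   where
   pairSet-distinct : pairSet i ≢ pairSet j
   pairSet-distinct eq = i≢j (trans (sym (pair-edge i zero))
     (proj₁ (pairSet-isPair j) (subst (edge i zero ∈_) eq (proj₂ (pairSet-isPair i) _ (pair-edge i zero)))))
   share-one : ∀ x y → VertOf G (pairSet i) x → VertOf G (pairSet j) x → VertOf G (pairSet i) y → VertOf G (pairSet j) y
             → x ≡ y
   share-one x y xi xj yi yj = pairs-share-one-vertex i≢j x y
     (vert-isPair _ i x (pairSet-isPair i) xi) (vert-isPair _ j x (pairSet-isPair j) xj)
     (vert-isPair _ i y (pairSet-isPair i) yi) (vert-isPair _ j y (pairSet-isPair j) yj)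

 handcuff⊆ : ∀ X i j → i ≢ j → fills X i ≡ true → fills X j ≡ true
           → ∃ λ C → Circuit C × C ⊆ X × (∀ k → pair k ≡ i → k ∈ C)
 handcuff⊆ X i j i≢j fi fj =
   pairSet i ∪ pairSet j , handcuff i j i≢j , ⊆X , λ k pk → SP.p⊆p∪q _ (proj₂ (pairSet-isPair i) k pk)
   where
   ⊆X : pairSet i ∪ pairSet j ⊆ X
   ⊆X {k} h with SP.x∈p∪q⁻ (pairSet i) (pairSet j) h
   ... | inj₁ hi = fills⁻ X i fi k (proj₁ (pairSet-isPair i) hi)
   ... | inj₂ hj = fills⁻ X j fj k (proj₁ (pairSet-isPair j) hj)

 IsHandcuff : Subset (R * 2) → Set
 IsHandcuff C = ∃₂ λ i j → i ≢ j × fills C i ≡ true × fills C j ≡ true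
                         × (∀ {k} → k ∈ C → pair k ≡ i ⊎ pair k ≡ j)

 isPair⇒fills : ∀ C i → IsPair C i → fills C i ≡ true
 isPair⇒fills C i (_ , all) = fills⁺ C i (all _ (pair-edge i zero)) (all _ (pair-edge i (suc zero)))

 isPair-unique : ∀ C D i → IsPair C i → IsPair D i → C ≡ D
 isPair-unique C D i (in-C , all-C) (in-D , all-D) = SP.⊆-antisym (λ h → all-D _ (in-C h)) (λ h → all-C _ (in-D h))

 isPair⇒ends : ∀ C j → IsPair C j → VertOf G C j × VertOf G C (next j)
 isPair⇒ends C j (_ , all) = (edge j zero , all _ (pair-edge j zero) , inj₁ (pair-edge j zero))
                            , (edge j zero , all _ (pair-edge j zero) , inj₂ (cong next (pair-edge j zero)))

 -- A transversal passes through every vertex, so it shares at least two vertices with any other cycle.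
 handcuff-shape : ∀ C₁ C₂ → C₁ ≢ C₂
   → (∀ x y → VertOf G C₁ x → VertOf G C₂ x → VertOf G C₁ y → VertOf G C₂ y → x ≡ y)
   → (∃ λ i → IsPair C₁ i) ⊎ IsTransversal C₁ → (∃ λ i → IsPair C₂ i) ⊎ IsTransversal C₂
   → IsHandcuff (C₁ ∪ C₂)
 handcuff-shape C₁ C₂ C₁≢C₂ share (inj₁ (i , pi)) (inj₁ (j , pj)) =
   i , j , i≢j , fills-mono C₁ _ (SP.p⊆p∪q C₂) i (isPair⇒fills C₁ i pi)
               , fills-mono C₂ _ (SP.q⊆p∪q C₁ C₂) j (isPair⇒fills C₂ j pj) , in-i-or-j
   where
   i≢j : i ≢ j
   i≢j refl = C₁≢C₂ (isPair-unique C₁ C₂ i pi pj)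
   in-i-or-j : ∀ {k} → k ∈ C₁ ∪ C₂ → pair k ≡ i ⊎ pair k ≡ j
   in-i-or-j h with SP.x∈p∪q⁻ C₁ C₂ h
   ... | inj₁ h₁ = inj₁ (proj₁ pi h₁)
   ... | inj₂ h₂ = inj₂ (proj₁ pj h₂)
 handcuff-shape C₁ C₂ _ share (inj₂ t₁) (inj₁ (j , pj)) = E.⊥-elim (next≢id j (sym
   (share j (next j) (vert-transversal C₁ j t₁) (proj₁ (isPair⇒ends C₂ j pj))
                     (vert-transversal C₁ (next j) t₁) (proj₂ (isPair⇒ends C₂ j pj)))))
 handcuff-shape C₁ C₂ _ share (inj₁ (j , pj)) (inj₂ t₂) = E.⊥-elim (next≢id j (sym
   (share j (next j) (proj₁ (isPair⇒ends C₁ j pj)) (vert-transversal C₂ j t₂)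
                     (proj₂ (isPair⇒ends C₁ j pj)) (vert-transversal C₂ (next j) t₂))))
 handcuff-shape C₁ C₂ _ share (inj₂ t₁) (inj₂ t₂) = E.⊥-elim (next≢id zero (sym
   (share zero (next zero) (vert-transversal C₁ _ t₁) (vert-transversal C₂ _ t₂)
                           (vert-transversal C₁ _ t₁) (vert-transversal C₂ _ t₂))))

 circuit-shape : ∀ C → Circuit C → (IsTransversal C × B C) ⊎ ThetaShape C ⊎ IsHandcuff C
 circuit-shape C (inj₁ (_ , b))          = inj₁ (balanced⇒transversal C b , b)
 circuit-shape C (inj₂ (inj₁ (θ , _)))   = inj₂ (inj₁ (theta-shape C θ))
 circuit-shape C (inj₂ (inj₂ (C₁ , C₂ , c₁ , c₂ , _ , _ , C₁≢C₂ , share , refl))) =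
   inj₂ (inj₂ (handcuff-shape C₁ C₂ C₁≢C₂ share (cycle-shape C₁ c₁) (cycle-shape C₂ c₂)))

 spanning⇒#touched≡R : ∀ I → (∀ y → touches I y ≡ true) → #touched I ≡ R
 spanning⇒#touched≡R I = count-all (touches I)

 #touched≡R⇒spanning : ∀ I → #touched I ≡ R → ∀ y → touches I y ≡ true
 #touched≡R⇒spanning I e y with touches I y in eq
 ... | true  = refl
 ... | false = E.⊥-elim (NP.<-irrefl e (count< (touches I) y eq))

 #filled≡0⇒fills-nothing : ∀ I → #filled I ≡ 0 → ∀ i → fills I i ≡ false
 #filled≡0⇒fills-nothing I e i = ¬-not (λ fi → NP.<-irrefl (sym e) (true⇒count≥1 (fills I) i fi))

 transversal-touches : ∀ C → IsTransversal C → ∀ y → touches C y ≡ true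
 transversal-touches C (covers , _) y with covers y
 ... | k , k∈ , refl = touches⁺ C k k∈

 transversal-fills-nothing : ∀ C → IsTransversal C → ∀ I → I ⊆ C → ∀ i → fills I i ≡ false
 transversal-fills-nothing C (_ , injective) I I⊆C i = ¬-not λ fi →
   edge₀≢edge₁ i (injective (I⊆C (fills⁻ I i fi _ (pair-edge i zero))) (I⊆C (fills⁻ I i fi _ (pair-edge i (suc zero))))
                            (trans (pair-edge i zero) (sym (pair-edge i (suc zero)))))

 spanning⊆transversal : ∀ C → IsTransversal C → ∀ I → I ⊆ C → (∀ y → touches I y ≡ true) → I ≡ C
 spanning⊆transversal C (_ , injective) I I⊆C spanning = SP.⊆-antisym I⊆C C⊆I
   where
   C⊆I : C ⊆ I
   C⊆I {k} k∈ with touches⁻ I (pair k) (spanning (pair k))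
   ... | k′ , pk′ , k′∈ = subst (_∈ I) (injective (I⊆C k′∈) k∈ pk′) k′∈

 transversal⊆fills-nothing : ∀ C → IsTransversal C → ∀ I → C ⊆ I → (∀ i → fills I i ≡ false) → I ≡ C
 transversal⊆fills-nothing C (covers , _) I C⊆I fills-nothing = SP.⊆-antisym I⊆C C⊆I
   where
   I⊆C : I ⊆ C
   I⊆C {k} k∈ with covers (pair k)
   ... | k′ , k′∈ , pk′ with k ≟ k′
   ... | yes refl = k′∈
   ... | no  k≢k′ = E.⊥-elim (true≢false (trans (sym (fills-two I (pair k) k k′ k≢k′ refl pk′ k∈ (C⊆I k′∈)))
                                                 (fills-nothing (pair k))))

 Sparse : Subset (R * 2) → Set
 Sparse I = (#filled I ≤ 1 × #touched I < R) ⊎ (#filled I ≡ 0 × #touched I ≡ R × ¬ B I)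

 sparse-no-balanced : ∀ I C → Sparse I → C ⊆ I → IsTransversal C → B C → E.⊥
 sparse-no-balanced I C sparse C⊆I transversal b with sparse
 ... | inj₁ (_ , #touched<R) = NP.<-irrefl spans #touched<R
   where
   spans : #touched I ≡ R
   spans = spanning⇒#touched≡R I (λ y → touches-mono C I C⊆I y (transversal-touches C transversal y))
 ... | inj₂ (#filled≡0 , _ , unbalanced) =
   unbalanced (subst B (sym (transversal⊆fills-nothing C transversal I C⊆I (#filled≡0⇒fills-nothing I #filled≡0))) b)

 sparse-no-theta : ∀ I C → Sparse I → C ⊆ I → ThetaShape C → E.⊥
 sparse-no-theta I C (inj₁ (_ , #touched<R)) C⊆I (_ , _ , spanning) =
   NP.<-irrefl (spanning⇒#touched≡R I (λ y → touches-mono C I C⊆I y (spanning y))) #touched<R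
 sparse-no-theta I C (inj₂ (#filled≡0 , _ , _)) C⊆I (i , fi , _) =
   NP.<-irrefl (sym #filled≡0) (true⇒count≥1 (fills I) i (fills-mono C I C⊆I i fi))

 sparse-no-handcuff : ∀ I C → Sparse I → C ⊆ I → IsHandcuff C → E.⊥
 sparse-no-handcuff I C sparse C⊆I (i , j , i≢j , fi , fj , _) = NP.<⇒≱ (s≤s (s≤s z≤n)) (#filled≤1 sparse)
   where
   two : 2 ≤ #filled I
   two = true⇒count≥2 (fills I) i j i≢j (fills-mono C I C⊆I i fi) (fills-mono C I C⊆I j fj)
   #filled≤1 : Sparse I → 2 ≤ 1
   #filled≤1 (inj₁ (≤1 , _))     = NP.≤-trans two ≤1
   #filled≤1 (inj₂ (≡0 , _ , _)) = NP.≤-trans two (NP.≤-trans (NP.≤-reflexive ≡0) z≤n)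

 sparse⇒independent : ∀ I → Sparse I → Indep I
 sparse⇒independent I sparse C circuit C⊆I with circuit-shape C circuit
 ... | inj₁ (transversal , b) = sparse-no-balanced I C sparse C⊆I transversal b
 ... | inj₂ (inj₁ θ)          = sparse-no-theta I C sparse C⊆I θ
 ... | inj₂ (inj₂ h)          = sparse-no-handcuff I C sparse C⊆I h

 independent⇒sparse : ∀ I → Indep I → Sparse I
 independent⇒sparse I indep with #filled I NP.≤? 1
 ... | no #filled≰1 with count≥2⇒true (fills I) (NP.≰⇒> #filled≰1)
 ... | i , j , i≢j , fi , fj = let (C , circuit , C⊆I , _) = handcuff⊆ I i j i≢j fi fj in E.⊥-elim (indep C circuit C⊆I)
 independent⇒sparse I indep | yes #filled≤1 with NP.m≤n⇒m<n∨m≡n (count≤ (touches I))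
 ... | inj₁ #touched<R = inj₁ (#filled≤1 , #touched<R)
 ... | inj₂ #touched≡R with #filled I in #filled≡
 ... | zero = inj₂ (refl , #touched≡R , λ b → let (c , eq , _) = B-hamiltonian I b in indep I (inj₁ ((c , eq) , b)) (λ h → h))
 ... | suc zero = E.⊥-elim (indep I theta (λ h → h))
   where
   i : Fin R
   i = proj₁ (count≥1⇒true (fills I) (NP.≤-reflexive (sym #filled≡)))
   fi : fills I i ≡ true
   fi = proj₂ (count≥1⇒true (fills I) (NP.≤-reflexive (sym #filled≡)))
   only-i : ∀ y → y ≢ i → fills I y ≡ false
   only-i y y≢i = ¬-not λ fy →
     NP.<-irrefl refl (NP.≤-trans (true⇒count≥2 (fills I) y i y≢i fy fi) (NP.≤-reflexive #filled≡))
   theta : Circuit I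
   theta = ThetaOfFullPair.circuit I i fi (#touched≡R⇒spanning I #touched≡R) only-i B (pairSet-unbalanced i)
 ... | suc (suc _) with s≤s () ← #filled≤1

 sparse⇒size≤R : ∀ I → Sparse I → ∣ I ∣ ≤ R
 sparse⇒size≤R I (inj₁ (#filled≤1 , #touched<R)) = begin
   ∣ I ∣                    ≡⟨ ∣X∣≡#touched+#filled R I ⟩
   #touched I + #filled I   ≤⟨ NP.+-monoʳ-≤ (#touched I) #filled≤1 ⟩
   #touched I + 1           ≡⟨ NP.+-comm (#touched I) 1 ⟩
   suc (#touched I)         ≤⟨ #touched<R ⟩
   R                        ∎
   where open NP.≤-Reasoning
 sparse⇒size≤R I (inj₂ (#filled≡0 , #touched≡R , _)) =
   NP.≤-reflexive (trans (∣X∣≡#touched+#filled R I) (trans (cong₂ _+_ #touched≡R #filled≡0) (NP.+-identityʳ R)))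

 independent⇒size≤R : ∀ I → Indep I → ∣ I ∣ ≤ R
 independent⇒size≤R I indep = sparse⇒size≤R I (independent⇒sparse I indep)

 -- trim X z i₀ drops the pair z, keeps the pair i₀, and keeps one edge of each other pair of X.

 keep : Bool → Bool → Bool × Bool → Bool × Bool
 keep true  _     _       = false , false
 keep false true  xy      = xy
 keep false false (x , y) = x , y ∧ not x

 choice : Subset (R * 2) → Fin R → Fin R → Fin R → Bool × Bool
 choice X z i₀ i = keep (does (i ≟ z)) (does (i ≟ i₀)) (has₀ X i , has₁ X i)

 trim : Subset (R * 2) → Fin R → Fin R → Subset (R * 2)
 trim X z i₀ = pairwise (choice X z i₀)

 either-keep : ∀ a c x y → either (keep a c (x , y)) ≡ (if a then false else x ∨ y)
 either-keep true  c     x     y     = refl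
 either-keep false true  x     y     = refl
 either-keep false false true  y     = refl
 either-keep false false false y     = ∧-identityʳ y

 both-keep : ∀ {i z i₀ : Fin R} (i≟z : Dec (i ≡ z)) (i≟i₀ : Dec (i ≡ i₀)) x y
           → both (keep (does i≟z) (does i≟i₀) (x , y)) ≡ true → i ≡ i₀ × i ≢ z
 both-keep (yes _)   _            x     y     ()
 both-keep (no  i≢z) (yes i≡i₀)   x     y     _  = i≡i₀ , i≢z
 both-keep (no  _)   (no  _)      true  true  ()
 both-keep (no  _)   (no  _)      true  false ()
 both-keep (no  _)   (no  _)      false y     ()

 keep⊆ : ∀ a c x y j → sel (keep a c (x , y)) j ≡ true → sel (x , y) j ≡ true
 keep⊆ true  c     x     y     zero       ()
 keep⊆ true  c     x     y     (suc zero) ()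
 keep⊆ false true  x     y     j          h = h
 keep⊆ false false x     y     zero       h = h
 keep⊆ false false true  y     (suc zero) h = ∧-trueˡ y h
 keep⊆ false false false y     (suc zero) h = ∧-trueˡ y h

 trim⊆ : ∀ X z i₀ → trim X z i₀ ⊆ X
 trim⊆ X z i₀ = pairwise-⊆ (choice X z i₀) X kept
   where
   kept : ∀ i j → sel (choice X z i₀ i) j ≡ true → edge i j ∈ X
   kept i zero       h = lookup⇒∈ (keep⊆ (does (i ≟ z)) (does (i ≟ i₀)) (has₀ X i) (has₁ X i) zero h)
   kept i (suc zero) h = lookup⇒∈ (keep⊆ (does (i ≟ z)) (does (i ≟ i₀)) (has₀ X i) (has₁ X i) (suc zero) h)

 touches-trim : ∀ X z i₀ i → touches (trim X z i₀) i ≡ remove (touches X) z i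
 touches-trim X z i₀ i =
   trans (touches-pairwise (choice X z i₀) i) (either-keep (does (i ≟ z)) (does (i ≟ i₀)) (has₀ X i) (has₁ X i))

 fills-trim : ∀ X z i₀ i → fills (trim X z i₀) i ≡ true → i ≡ i₀ × i ≢ z
 fills-trim X z i₀ i h = both-keep (i ≟ z) (i ≟ i₀) (has₀ X i) (has₁ X i) (trans (sym (fills-pairwise (choice X z i₀) i)) h)

 fills-trim-i₀ : ∀ X z i₀ → i₀ ≢ z → fills (trim X z i₀) i₀ ≡ fills X i₀
 fills-trim-i₀ X z i₀ i₀≢z = trans (fills-pairwise (choice X z i₀) i₀) (kept (i₀ ≟ z) (i₀ ≟ i₀))
   where
   kept : ∀ (a? : Dec (i₀ ≡ z)) (c? : Dec (i₀ ≡ i₀))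
        → both (keep (does a?) (does c?) (has₀ X i₀ , has₁ X i₀)) ≡ fills X i₀
   kept (yes i₀≡z) _          = E.⊥-elim (i₀≢z i₀≡z)
   kept (no _)     (yes _)    = refl
   kept (no _)     (no i₀≢i₀) = E.⊥-elim (i₀≢i₀ refl)

 #filled-trim : ∀ X z i₀ → #filled (trim X z i₀) ≡ indicator (fills (trim X z i₀) i₀)
 #filled-trim X z i₀ =
   count-only (fills (trim X z i₀)) i₀ λ i i≢i₀ → ¬-not λ fi → i≢i₀ (proj₁ (fills-trim X z i₀ i fi))

 trim-independent : ∀ X z i₀ → Indep (trim X z i₀)
 trim-independent X z i₀ = sparse⇒independent _ (inj₁ (#filled≤1 , #touched<R))
   where
   #filled≤1 : #filled (trim X z i₀) ≤ 1
   #filled≤1 = subst (_≤ 1) (sym (#filled-trim X z i₀)) (indicator≤1 _)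
   #touched<R : #touched (trim X z i₀) < R
   #touched<R = count< (touches (trim X z i₀)) z
     (trans (touches-trim X z i₀ z) (cong (λ a → if a then false else touches X z) (dec-true (z ≟ z) refl)))

 ∣trim∣ : ∀ X z i₀ → ∣ trim X z i₀ ∣ + indicator (touches X z) ≡ #touched X + #filled (trim X z i₀)
 ∣trim∣ X z i₀ = begin
   ∣ J ∣ + indicator (touches X z)
     ≡⟨ cong (_+ indicator (touches X z)) (∣X∣≡#touched+#filled R J) ⟩
   #touched J + #filled J + indicator (touches X z)
     ≡⟨ xy∙z≈zx∙y (#touched J) (#filled J) (indicator (touches X z)) ⟩
   indicator (touches X z) + #touched J + #filled J
     ≡⟨ cong (λ t → indicator (touches X z) + t + #filled J) (count-cong _ _ (touches-trim X z i₀)) ⟩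
   indicator (touches X z) + count (remove (touches X) z) + #filled J
     ≡⟨ cong (_+ #filled J) (count-remove (touches X) z) ⟨
   #touched X + #filled J ∎
   where
   open ≡-Reasoning
   J : Subset (R * 2)
   J = trim X z i₀

 trim-size-missing : ∀ X z i₀ → touches X z ≡ false → fills X i₀ ≡ true → ∣ trim X z i₀ ∣ ≡ suc (#touched X)
 trim-size-missing X z i₀ tz fi₀ = begin
   ∣ trim X z i₀ ∣                                ≡⟨ NP.+-identityʳ _ ⟨
   ∣ trim X z i₀ ∣ + 0                            ≡⟨ cong (λ b → ∣ trim X z i₀ ∣ + indicator b) tz ⟨
   ∣ trim X z i₀ ∣ + indicator (touches X z)      ≡⟨ ∣trim∣ X z i₀ ⟩
   #touched X + #filled (trim X z i₀)             ≡⟨ cong (#touched X +_) (#filled-trim X z i₀) ⟩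
   #touched X + indicator (fills (trim X z i₀) i₀) ≡⟨ cong (λ b → #touched X + indicator b) (fills-trim-i₀ X z i₀ i₀≢z) ⟩
   #touched X + indicator (fills X i₀)            ≡⟨ cong (λ b → #touched X + indicator b) fi₀ ⟩
   #touched X + 1                                 ≡⟨ NP.+-comm (#touched X) 1 ⟩
   suc (#touched X)                               ∎
   where
   open ≡-Reasoning
   i₀≢z : i₀ ≢ z
   i₀≢z refl = true≢false (trans (sym (fills⇒touches X i₀ fi₀)) tz)

 spanning-basis : ∀ Y i₀ → (∀ y → touches Y y ≡ true) → fills Y i₀ ≡ true
                → ∃ λ J → J ⊆ Y × Indep J × ∣ J ∣ ≡ R
 spanning-basis Y i₀ spanning fi₀ = J , trim⊆ Y z i₀ , trim-independent Y z i₀ , NP.suc-injective size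
   where
   z : Fin R
   z = next i₀
   J : Subset (R * 2)
   J = trim Y z i₀
   size : suc ∣ J ∣ ≡ suc R
   size = begin
     suc ∣ J ∣                      ≡⟨ NP.+-comm 1 _ ⟩
     ∣ J ∣ + 1                      ≡⟨ cong (λ b → ∣ J ∣ + indicator b) (spanning z) ⟨
     ∣ J ∣ + indicator (touches Y z) ≡⟨ ∣trim∣ Y z i₀ ⟩
     #touched Y + #filled J         ≡⟨ cong₂ _+_ (spanning⇒#touched≡R Y spanning) (#filled-trim Y z i₀) ⟩
     R + indicator (fills J i₀)     ≡⟨ cong (λ b → R + indicator b) (trans (fills-trim-i₀ Y z i₀ (next≢id i₀ ∘ sym)) fi₀) ⟩
     R + 1                          ≡⟨ NP.+-comm R 1 ⟩
     suc R                          ∎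
     where open ≡-Reasoning

 -- Ranks

 rank-of-basis : ∀ X J → J ⊆ X → Indep J → ∣ J ∣ ≡ R → HasRank Circuit X R
 rank-of-basis X J J⊆X indep ∣J∣≡R = (J , J⊆X , indep , ∣J∣≡R) , λ I _ → independent⇒size≤R I

 rank-unique : ∀ X k k′ → HasRank Circuit X k → HasRank Circuit X k′ → k ≡ k′
 rank-unique X k k′ ((I , I⊆X , indep , ∣I∣≡k) , max) ((I′ , I′⊆X , indep′ , ∣I′∣≡k′) , max′) =
   NP.≤-antisym (subst (_≤ k′) ∣I∣≡k (max′ I I⊆X indep)) (subst (_≤ k) ∣I′∣≡k′ (max I′ I′⊆X indep′))

 touches-⊤ : ∀ i → touches ⊤ i ≡ true
 touches-⊤ i = cong (_∨ has₁ ⊤ i) (VP.lookup-replicate (edge i zero) true)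

 fills-⊤ : ∀ i → fills ⊤ i ≡ true
 fills-⊤ i = cong₂ _∧_ (VP.lookup-replicate (edge i zero) true) (VP.lookup-replicate (edge i (suc zero)) true)

 rank-⊤ : HasRank Circuit ⊤ R
 rank-⊤ = let (J , _ , indep , ∣J∣≡R) = spanning-basis ⊤ zero touches-⊤ (fills-⊤ zero)
          in rank-of-basis ⊤ J SP.⊆⊤ indep ∣J∣≡R

 singleton-independent : ∀ e → Indep ⁅ e ⁆
 singleton-independent e = sparse⇒independent ⁅ e ⁆ (inj₁ (#filled≤1 , #touched<R))
   where
   sum≡1 : #touched ⁅ e ⁆ + #filled ⁅ e ⁆ ≡ 1
   sum≡1 = trans (sym (∣X∣≡#touched+#filled R ⁅ e ⁆)) (SP.∣⁅x⁆∣≡1 e)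
   #filled≤1 : #filled ⁅ e ⁆ ≤ 1
   #filled≤1 = subst (#filled ⁅ e ⁆ ≤_) sum≡1 (NP.m≤n+m (#filled ⁅ e ⁆) (#touched ⁅ e ⁆))
   #touched<R : #touched ⁅ e ⁆ < R
   #touched<R = NP.≤-<-trans (subst (#touched ⁅ e ⁆ ≤_) sum≡1 (NP.m≤m+n (#touched ⁅ e ⁆) (#filled ⁅ e ⁆)))
                             (s≤s (s≤s z≤n))

 rank-⊥ : HasRank Circuit ⊥ 0
 rank-⊥ = (⊥ , (λ h → h) , ⊥-independent , SP.∣⊥∣≡0 (R * 2))
        , λ I I⊆⊥ _ → subst (∣ I ∣ ≤_) (SP.∣⊥∣≡0 (R * 2)) (SP.p⊆q⇒∣p∣≤∣q∣ I⊆⊥)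
   where
   ⊥-independent : Indep ⊥
   ⊥-independent C circuit C⊆⊥ = singleton-independent zero C circuit (λ h → E.⊥-elim (SP.∉⊥ (C⊆⊥ h)))

 rank-balanced : ∀ X → B X → HasRank Circuit X n
 rank-balanced X b = (J , trim⊆ X zero zero , trim-independent X zero zero , size) , max
   where
   transversal : IsTransversal X
   transversal = balanced⇒transversal X b
   J : Subset (R * 2)
   J = trim X zero zero
   size : ∣ J ∣ ≡ n
   size = NP.suc-injective (begin
     suc ∣ J ∣                           ≡⟨ NP.+-comm 1 _ ⟩
     ∣ J ∣ + 1                           ≡⟨ cong (λ b → ∣ J ∣ + indicator b) (transversal-touches X transversal zero) ⟨
     ∣ J ∣ + indicator (touches X zero)  ≡⟨ ∣trim∣ X zero zero ⟩
     #touched X + #filled J              ≡⟨ cong₂ _+_ (spanning⇒#touched≡R X (transversal-touches X transversal))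
                                                      (count-none (fills J) (transversal-fills-nothing X transversal J (trim⊆ X zero zero))) ⟩
     R + 0                               ≡⟨ NP.+-identityʳ R ⟩
     R                                   ∎)
     where open ≡-Reasoning
   max : ∀ I → I ⊆ X → Indep I → ∣ I ∣ ≤ n
   max I I⊆X indep with independent⇒sparse I indep
   ... | inj₁ (_ , #touched<R) = subst (_≤ n) (sym ∣I∣≡#touched) (NP.≤-pred #touched<R)
     where
     ∣I∣≡#touched : ∣ I ∣ ≡ #touched I
     ∣I∣≡#touched = trans (∣X∣≡#touched+#filled R I)
       (trans (cong (#touched I +_) (count-none (fills I) (transversal-fills-nothing X transversal I I⊆X))) (NP.+-identityʳ _))
   ... | inj₂ (_ , #touched≡R , unbalanced) =
     E.⊥-elim (unbalanced (subst B (sym (spanning⊆transversal X transversal I I⊆X (#touched≡R⇒spanning I #touched≡R))) b))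

 rank-pairsUnion : ∀ S → 2 ≤ ∣ S ∣ → ∣ S ∣ ≤ suc m → HasRank Circuit (pairsUnion S) (suc ∣ S ∣)
 rank-pairsUnion S two ≤R-2 = (trim X z i₀ , trim⊆ X z i₀ , trim-independent X z i₀ , size) , max
   where
   X : Subset (R * 2)
   X = pairsUnion S
   #touched<R : #touched X < R
   #touched<R = subst (_< R) (sym (#touched-pairsUnion S)) (s≤s (NP.m≤n⇒m≤1+n ≤R-2))
   z : Fin R
   z = proj₁ (count<⇒false (touches X) #touched<R)
   i₀ : Fin R
   i₀ = proj₁ (count≥1⇒true (lookup S) (subst (1 ≤_) (∣S∣≡count S) (NP.≤-trans (s≤s z≤n) two)))
   size : ∣ trim X z i₀ ∣ ≡ suc ∣ S ∣
   size = trans (trim-size-missing X z i₀ (proj₂ (count<⇒false (touches X) #touched<R))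
                  (trans (fills-pairsUnion S i₀) (proj₂ (count≥1⇒true (lookup S) _))))
                (cong suc (#touched-pairsUnion S))
   #touched≤ : ∀ I → I ⊆ X → #touched I ≤ ∣ S ∣
   #touched≤ I I⊆X = subst (#touched I ≤_) (#touched-pairsUnion S) (count-mono _ _ (touches-mono I X I⊆X))
   max : ∀ I → I ⊆ X → Indep I → ∣ I ∣ ≤ suc ∣ S ∣
   max I I⊆X indep with independent⇒sparse I indep
   ... | inj₁ (#filled≤1 , _) = begin
     ∣ I ∣                  ≡⟨ ∣X∣≡#touched+#filled R I ⟩
     #touched I + #filled I ≤⟨ NP.+-mono-≤ (#touched≤ I I⊆X) #filled≤1 ⟩
     ∣ S ∣ + 1              ≡⟨ NP.+-comm ∣ S ∣ 1 ⟩
     suc ∣ S ∣              ∎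
     where open NP.≤-Reasoning
   ... | inj₂ (_ , #touched≡R , _) =
     E.⊥-elim (NP.<-irrefl #touched≡R (NP.≤-<-trans (#touched≤ I I⊆X) (s≤s (NP.m≤n⇒m≤1+n ≤R-2))))

 -- Cyclic flats

 flat-from-rank : ∀ X k → HasRank Circuit X k
                → (∀ e → e ∉ X → ∃ λ J → J ⊆ X ∪ ⁅ e ⁆ × Indep J × k < ∣ J ∣) → IsFlat Circuit X
 flat-from-rank X k rank-k bigger e e∉X k′ rank-k′ rank-k′-∪ with rank-unique X k′ k rank-k′ rank-k | bigger e e∉X
 ... | refl | J , J⊆ , indep , k<∣J∣ = NP.<⇒≱ k<∣J∣ (proj₂ rank-k′-∪ J J⊆ indep)

 cyclicFlat-⊤ : IsCyclicFlat Circuit ⊤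
 cyclicFlat-⊤ = (λ e e∉⊤ → E.⊥-elim (e∉⊤ SP.∈⊤)) , union
   where
   union : IsUnionOfCircuits Circuit ⊤
   union e _ with handcuff⊆ ⊤ (pair e) (next (pair e)) (next≢id _ ∘ sym) (fills-⊤ (pair e)) (fills-⊤ (next (pair e)))
   ... | C , circuit , _ , pair⊆C = C , circuit , SP.⊆⊤ , pair⊆C e refl

 cyclicFlat-⊥ : IsCyclicFlat Circuit ⊥
 cyclicFlat-⊥ = flat-from-rank ⊥ 0 rank-⊥ bigger , λ e e∈⊥ → E.⊥-elim (SP.∉⊥ e∈⊥)
   where
   bigger : ∀ e → e ∉ ⊥ → ∃ λ J → J ⊆ ⊥ ∪ ⁅ e ⁆ × Indep J × 0 < ∣ J ∣
   bigger e _ = ⁅ e ⁆ , SP.q⊆p∪q ⊥ ⁅ e ⁆ , singleton-independent e , NP.≤-reflexive (sym (SP.∣⁅x⁆∣≡1 e))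

 cyclicFlat-balanced : ∀ X → B X → IsCyclicFlat Circuit X
 cyclicFlat-balanced X b = flat-from-rank X n (rank-balanced X b) bigger , λ e e∈X → X , inj₁ (cycle , b) , (λ h → h) , e∈X
   where
   cycle : IsCycle G X
   cycle = let (c , eq , _) = B-hamiltonian X b in c , eq
   transversal : IsTransversal X
   transversal = balanced⇒transversal X b
   bigger : ∀ e → e ∉ X → ∃ λ J → J ⊆ X ∪ ⁅ e ⁆ × Indep J × n < ∣ J ∣
   bigger e e∉X with proj₁ transversal (pair e)
   ... | k , k∈X , pk with spanning-basis (X ∪ ⁅ e ⁆) (pair e) spanning full
     where
     spanning : ∀ y → touches (X ∪ ⁅ e ⁆) y ≡ true
     spanning y = touches-mono X _ (SP.p⊆p∪q _) y (transversal-touches X transversal y)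
     full : fills (X ∪ ⁅ e ⁆) (pair e) ≡ true
     full = fills-two _ (pair e) k e (λ k≡e → e∉X (subst (_∈ X) k≡e k∈X)) pk refl
                      (SP.p⊆p∪q _ k∈X) (SP.q⊆p∪q X ⁅ e ⁆ (SP.x∈⁅x⁆ e))
   ... | J , J⊆ , indep , ∣J∣≡R = J , J⊆ , indep , NP.≤-reflexive (sym ∣J∣≡R)

 cyclicFlat-pairsUnion : ∀ S → 2 ≤ ∣ S ∣ → ∣ S ∣ ≤ suc m → IsCyclicFlat Circuit (pairsUnion S)
 cyclicFlat-pairsUnion S two ≤R-2 = flat-from-rank X (suc ∣ S ∣) (rank-pairsUnion S two ≤R-2) bigger , union
   where
   X : Subset (R * 2)
   X = pairsUnion S
   fills-X : ∀ i → lookup S i ≡ true → fills X i ≡ true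
   fills-X i si = trans (fills-pairsUnion S i) si
   other-pair : ∀ i → ∃ λ j → i ≢ j × lookup S j ≡ true
   other-pair i with count≥2⇒true (lookup S) (subst (2 ≤_) (∣S∣≡count S) two)
   ... | a , b , a≢b , sa , sb with a ≟ i
   ... | yes refl = b , a≢b , sb
   ... | no  a≢i  = a , a≢i ∘ sym , sa
   union : IsUnionOfCircuits Circuit X
   union e e∈X with other-pair (pair e)
   ... | j , i≢j , sj with handcuff⊆ X (pair e) j i≢j (fills-X (pair e) (pairsUnion⁻ S e e∈X)) (fills-X j sj)
   ... | C , circuit , C⊆X , pair⊆C = C , circuit , C⊆X , pair⊆C e refl
   bigger : ∀ e → e ∉ X → ∃ λ J → J ⊆ X ∪ ⁅ e ⁆ × Indep J × suc ∣ S ∣ < ∣ J ∣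
   bigger e e∉X = J , trim⊆ Y z i₀ , trim-independent Y z i₀ , NP.≤-reflexive (sym size)
     where
     Y : Subset (R * 2)
     Y = X ∪ ⁅ e ⁆
     #touched-Y : #touched Y ≡ suc ∣ S ∣
     #touched-Y = #touched-add-pair S e (¬-not λ se → e∉X (pairsUnion⁺ S e se))
     #touched<R : #touched Y < R
     #touched<R = subst (_< R) (sym #touched-Y) (s≤s (s≤s ≤R-2))
     z : Fin R
     z = proj₁ (count<⇒false (touches Y) #touched<R)
     s₀ : ∃ λ i → lookup S i ≡ true
     s₀ = count≥1⇒true (lookup S) (subst (1 ≤_) (∣S∣≡count S) (NP.≤-trans (s≤s z≤n) two))
     i₀ : Fin R
     i₀ = proj₁ s₀
     J : Subset (R * 2)
     J = trim Y z i₀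
     size : ∣ J ∣ ≡ suc (suc ∣ S ∣)
     size = trans (trim-size-missing Y z i₀ (proj₂ (count<⇒false (touches Y) #touched<R))
                                      (fills-mono X Y (SP.p⊆p∪q _) i₀ (fills-X i₀ (proj₂ s₀))))
                  (cong suc #touched-Y)

 NoFullBasis : Subset (R * 2) → Set
 NoFullBasis X = ∀ J → J ⊆ X → Indep J → ∣ J ∣ ≡ R → E.⊥

 proper-flat⇒no-full-basis : ∀ X e → e ∉ X → IsFlat Circuit X → NoFullBasis X
 proper-flat⇒no-full-basis X e e∉X flat J J⊆X indep ∣J∣≡R =
   flat e e∉X R (rank-of-basis X J J⊆X indep ∣J∣≡R)
                (rank-of-basis (X ∪ ⁅ e ⁆) J (λ h → SP.p⊆p∪q ⁅ e ⁆ (J⊆X h)) indep ∣J∣≡R)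

 no-spanning-full-pair : ∀ X → NoFullBasis X → (∀ y → touches X y ≡ true) → ∀ i → fills X i ≡ true → E.⊥
 no-spanning-full-pair X no-basis spanning i fi with spanning-basis X i spanning fi
 ... | J , J⊆X , indep , ∣J∣≡R = no-basis J J⊆X indep ∣J∣≡R

 no-theta : ∀ X → NoFullBasis X → ∀ C → ThetaShape C → C ⊆ X → E.⊥
 no-theta X no-basis C (i , fi , spanning) C⊆X =
   no-spanning-full-pair X no-basis (λ y → touches-mono C X C⊆X y (spanning y)) i (fills-mono C X C⊆X i fi)

 no-transversal-and-full-pair : ∀ X → NoFullBasis X → ∀ C → IsTransversal C → C ⊆ X
                              → ∀ i → fills X i ≡ true → E.⊥
 no-transversal-and-full-pair X no-basis C transversal C⊆X =
   no-spanning-full-pair X no-basis (λ y → touches-mono C X C⊆X y (transversal-touches C transversal y))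

 balanced-flat : ∀ X → NoFullBasis X → ∀ C → IsTransversal C → C ⊆ X → X ≡ C
 balanced-flat X no-basis C transversal C⊆X = transversal⊆fills-nothing C transversal X C⊆X
   λ i → ¬-not (no-transversal-and-full-pair X no-basis C transversal C⊆X i)

 -- Once some pair is full, every circuit in X is a handcuff, so every edge of X lies in a full pair.
 edges-in-full-pairs : ∀ X → NoFullBasis X → IsUnionOfCircuits Circuit X → ∀ i → fills X i ≡ true
                     → ∀ f → f ∈ X → fills X (pair f) ≡ true
 edges-in-full-pairs X no-basis union i fi f f∈X with union f f∈X
 ... | C , circuit , C⊆X , f∈C with circuit-shape C circuit
 ... | inj₁ (transversal , _) = E.⊥-elim (no-transversal-and-full-pair X no-basis C transversal C⊆X i fi)
 ... | inj₂ (inj₁ θ)          = E.⊥-elim (no-theta X no-basis C θ C⊆X)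
 ... | inj₂ (inj₂ (a , b , _ , fa , fb , in-a-or-b)) with in-a-or-b f∈C
 ... | inj₁ pf≡a = subst (λ y → fills X y ≡ true) (sym pf≡a) (fills-mono C X C⊆X a fa)
 ... | inj₂ pf≡b = subst (λ y → fills X y ≡ true) (sym pf≡b) (fills-mono C X C⊆X b fb)

 pairs-flat : ∀ X e → e ∉ X → NoFullBasis X → IsUnionOfCircuits Circuit X
            → ∀ i j → i ≢ j → fills X i ≡ true → fills X j ≡ true
            → ∃ λ p → 2 ≤ p × p ≤ R ∸ 2 × IsUnionOfPairs R X p
 pairs-flat X e e∉X no-basis union i j i≢j fi fj = ∣ S ∣ , two , ≤R-2 , S , refl , X≡
   where
   full : ∀ f → f ∈ X → fills X (pair f) ≡ true
   full = edges-in-full-pairs X no-basis union i fi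
   S : Subset R
   S = tabulate (fills X)
   lookup-S : ∀ a → lookup S a ≡ fills X a
   lookup-S = VP.lookup∘tabulate (fills X)
   X≡ : X ≡ pairsUnion S
   X≡ = SP.⊆-antisym (λ {k} k∈ → pairsUnion⁺ S k (trans (lookup-S (pair k)) (full k k∈)))
                     (λ {k} k∈ → fills⁻ X (pair k) (trans (sym (lookup-S (pair k))) (pairsUnion⁻ S k k∈)) k refl)
   ∣S∣≡#filled : ∣ S ∣ ≡ #filled X
   ∣S∣≡#filled = trans (∣S∣≡count S) (count-cong _ _ lookup-S)
   two : 2 ≤ ∣ S ∣
   two = subst (2 ≤_) (sym ∣S∣≡#filled) (true⇒count≥2 (fills X) i j i≢j fi fj)
   e-not-full : fills X (pair e) ≡ false
   e-not-full = ¬-not λ fe → e∉X (fills⁻ X (pair e) fe e refl)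
   touches≡fills : ∀ y → touches X y ≡ fills X y
   touches≡fills y = ≡-from-≡true touched⇒full (fills⇒touches X y)
     where
     touched⇒full : touches X y ≡ true → fills X y ≡ true
     touched⇒full ty with touches⁻ X y ty
     ... | k , pk , k∈ = subst (λ a → fills X a ≡ true) pk (full k k∈)
   -- With n = r − 1 full pairs, dropping the pair of e would leave r independent edges.
   #filled≢n : #filled X ≢ n
   #filled≢n #filled≡n = no-basis (trim X (pair e) i) (trim⊆ X (pair e) i) (trim-independent X (pair e) i) size
     where
     size : ∣ trim X (pair e) i ∣ ≡ R
     size = trans (trim-size-missing X (pair e) i (trans (touches≡fills (pair e)) e-not-full) fi)
                  (cong suc (trans (count-cong _ _ touches≡fills) #filled≡n))
   ≤R-2 : ∣ S ∣ ≤ suc m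
   ≤R-2 = subst (_≤ suc m) (sym ∣S∣≡#filled)
                (NP.≤-pred (NP.≤∧≢⇒< (NP.≤-pred (count< (fills X) (pair e) e-not-full)) #filled≢n))

 CyclicFlatShape : Subset (R * 2) → Set
 CyclicFlatShape X = X ≡ ⊤ ⊎ X ≡ ⊥ ⊎ B X ⊎ ∃ (λ p → 2 ≤ p × p ≤ R ∸ 2 × IsUnionOfPairs R X p)

 proper-cyclicFlat-shape : ∀ X e′ → e′ ∉ X → NoFullBasis X → IsUnionOfCircuits Circuit X → ∀ e → e ∈ X
                         → B X ⊎ ∃ (λ p → 2 ≤ p × p ≤ R ∸ 2 × IsUnionOfPairs R X p)
 proper-cyclicFlat-shape X e′ e′∉X no-basis union e e∈X with union e e∈X
 ... | C , circuit , C⊆X , _ with circuit-shape C circuit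
 ... | inj₁ (transversal , b) = inj₁ (subst B (sym (balanced-flat X no-basis C transversal C⊆X)) b)
 ... | inj₂ (inj₁ θ)          = E.⊥-elim (no-theta X no-basis C θ C⊆X)
 ... | inj₂ (inj₂ (i , j , i≢j , fi , fj , _)) =
   inj₂ (pairs-flat X e′ e′∉X no-basis union i j i≢j (fills-mono C X C⊆X i fi) (fills-mono C X C⊆X j fj))

 cyclicFlat⇒shape : ∀ X → IsCyclicFlat Circuit X → CyclicFlatShape X
 cyclicFlat⇒shape X (flat , union) with ⊤-or-missing X | ⊥-or-nonempty X
 ... | inj₁ X≡⊤         | _               = inj₁ X≡⊤
 ... | inj₂ _           | inj₁ X≡⊥        = inj₂ (inj₁ X≡⊥)
 ... | inj₂ (e′ , e′∉X) | inj₂ (e , e∈X) =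
   inj₂ (inj₂ (proper-cyclicFlat-shape X e′ e′∉X (proper-flat⇒no-full-basis X e′ e′∉X flat) union e e∈X))

 shape⇒cyclicFlat : ∀ X → CyclicFlatShape X → IsCyclicFlat Circuit X
 shape⇒cyclicFlat X (inj₁ refl)                                              = cyclicFlat-⊤
 shape⇒cyclicFlat X (inj₂ (inj₁ refl))                                       = cyclicFlat-⊥
 shape⇒cyclicFlat X (inj₂ (inj₂ (inj₁ b)))                                   = cyclicFlat-balanced X b
 shape⇒cyclicFlat X (inj₂ (inj₂ (inj₂ (_ , two , ≤R-2 , S , refl , refl)))) = cyclicFlat-pairsUnion S two ≤R-2

proposition3p3 : (r : ℕ) → 3 ≤ r → (B : Subset (r * 2) → Set)
    → (∀ C → B C → IsHamCycle (Δ r) C)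
    → IsLinearClass (Δ r) B
    → (∀ X → IsCyclicFlat (LiftCircuit (Δ r) B) X
    ⇔ (X ≡ ⊤ ⊎ X ≡ ⊥ ⊎ B X
    ⊎ ∃ (λ p → 2 ≤ p × p ≤ r ∸ 2 × IsUnionOfPairs r X p)))
    × HasRank (LiftCircuit (Δ r) B) ⊤ r
    × HasRank (LiftCircuit (Δ r) B) ⊥ 0
    × (∀ X → B X → HasRank (LiftCircuit (Δ r) B) X (r ∸ 1))
    × (∀ X p → 2 ≤ p → p ≤ r ∸ 2 → IsUnionOfPairs r X p
    → HasRank (LiftCircuit (Δ r) B) X (suc p))
proposition3p3 (suc (suc (suc m))) (s≤s (s≤s (s≤s z≤n))) B B-hamiltonian _ =
  (λ X → mk⇔ (cyclicFlat⇒shape X) (shape⇒cyclicFlat X)) , rank-⊤ , rank-⊥ , rank-balanced ,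
  λ { X _ two ≤r-2 (S , refl , refl) → rank-pairsUnion S two ≤r-2 }
  where open LiftMatroid m B B-hamiltonian
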